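{- Let $q$ be a prime power, $n\ge1$ with $\gcd(n,q)=1$, and let $C=C_{n,h,q}$ be the $q$-ary cyclic code of length $n$ with check polynomial $h(x)$ (a monic divisor of $x^n-1$). Let $m'=\deg(h)$ and $n'=\mathrm{ord}(h)$. Then $n'\mid n$ and $\dim(C)=m'$. If $n'<n$, then $C$ consists exactly of the codewords $(\mathbf{c}',\mathbf{c}',\dots,\mathbf{c}')$ ($n/n'$ copies) with $\mathbf{c}'\in C'$, where $C'=C_{n',h,q}$ is the non-degenerate cyclic code of length $n'$ with check polynomial $h$; moreover, with $k:=n/n'$, $\mathrm{PAut}(C)=S_k\wr\mathrm{PAut}(C')$, so $|\mathrm{PAut}(C)|=(k!)^{n'}|\mathrm{PAut}(C')|$. Finally, (for $n'<n$) $\mathrm{PAut}(C)\not\subseteq\mathrm{AG}(n)$, except in the following four cases: (1) $n=2$, $n'=1$, $h(x)=x-1$, $q$ odd ($C$ the repetition code of length $2$); here $\mathrm{PAut}(C)=S_2=\mathrm{AG}(2)=\langle\sigma,\psi\rangle$; (2) $n=3$, $n'=1$, $h(x)=x-1$, $q\equiv1,2\pmod 3$ ($C$ the repetition code of length $3$); here $\mathrm{PAut}(C)=S_3\cong\mathrm{AG}(3)$; (3) $n=4$, $n'=2$, $h(x)=x+1$, $q$ odd, $C$ the $\mathbb{F}_q$-span of $(1,-1,1,-1)$; here $\mathrm{PAut}(C)=S_2\wr S_2\cong\mathrm{AG}(4)$; (4) $n=4$, $n'=2$, $h(x)=x^2-1$, $q$ odd ($C$ the code of length $4$ over $\mathbb{F}_q$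 with check polynomial $x^2-1$); here $\mathrm{PAut}(C)=S_2\wr S_2\cong\mathrm{AG}(4)$.
   Context: A $q$-ary cyclic code of length $n$ is an ideal of $\mathbb{F}_q[x]/(x^n-1)$, generated by a monic $g\mid x^n-1$; its check polynomial is $h=(x^n-1)/g$, and $C_{n,h,q}$ denotes this code. $\mathrm{ord}(h)$ is the least $k\ge1$ with $h\mid x^k-1$; the code is non-degenerate if $\mathrm{ord}(h)=n$. Coordinates are indexed by $\mathbb{Z}_n$, the symmetric group $S_n$ acts by permuting coordinates, and $\mathrm{PAut}(C)$ is the setwise stabilizer of $C$. $\mathrm{AG}(n)$ is the group of maps $i\mapsto ti+a$ on $\mathbb{Z}_n$ with $t\in\mathbb{Z}_n^*$, $a\in\mathbb{Z}_n$; $\sigma:i\mapsto i+1$, $\psi:i\mapsto qi$. The wreath product $S_k\wr\mathrm{PAut}(C')$ is the semidirect product $S_k^{n'}\rtimes\mathrm{PAut}(C')$, with $\mathrm{PAut}(C')$ permuting the $n'$ factors. -}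

module Defs where

open import Level using (0ℓ)
open import Data.Nat using (ℕ; zero; suc; _≤_; _<_)
import Data.Nat as N
import Data.Fin as F
open import Data.Nat.DivMod using (m%n<n)
open import Data.Nat.Primality using (Prime)
open import Data.Nat.Coprimality using (Coprime)
open import Data.Fin using (Fin; toℕ; fromℕ<)
open import Data.List using (List; []; _∷_; _++_; map; replicate; tabulate)
open import Data.Vec using (Vec; toList)
open import Data.Product using (Σ; ∃; ∃-syntax; _×_; _,_)
open import Data.Sum using (_⊎_)
open import Function.Bundles using (_↔_; _⇔_)
open import Relation.Binary.PropositionalEquality using (_≡_)
open import Relation.Nullary using (¬_)
open import Algebra.Structures using (IsCommutativeRing)
open import Data.Fin.Permutation using (Permutation′; _⟨$⟩ʳ_)

IsPrimePower : ℕ → Set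
IsPrimePower q = ∃[ p ] ∃[ e ] (Prime p × 1 ≤ e × q ≡ p N.^ e)

reduce : ∀ {m} → 1 ≤ m → ℕ → Fin m
reduce {suc m} _ i = fromℕ< (m%n<n i (suc m))

record FiniteField (q : ℕ) : Set₁ where
  infixl 7 _*_
  infixl 6 _+_
  field
    Carrier  : Set
    _+_ _*_  : Carrier → Carrier → Carrier
    -_       : Carrier → Carrier
    0# 1#    : Carrier
    isCommutativeRing : IsCommutativeRing _≡_ _+_ _*_ -_ 0# 1#
    0≢1      : ¬ (0# ≡ 1#)
    inverse  : ∀ x → ¬ (x ≡ 0#) → ∃[ y ] (x * y ≡ 1#)
    enum     : Carrier ↔ Fin q

module _ {q : ℕ} (𝔽 : FiniteField q) where
  open FiniteField 𝔽

  -- Polynomials over F_q: coefficient lists, lowest degree first.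
  Poly : Set
  Poly = List Carrier

  coeff : Poly → ℕ → Carrier
  coeff []      _       = 0#
  coeff (a ∷ p) zero    = a
  coeff (a ∷ p) (suc i) = coeff p i

  -- equality of polynomials (coefficientwise, so trailing zeros are irrelevant)
  _≈ₚ_ : Poly → Poly → Set
  p ≈ₚ r = ∀ i → coeff p i ≡ coeff r i

  _+ₚ_ : Poly → Poly → Poly
  []      +ₚ r       = r
  (a ∷ p) +ₚ []      = a ∷ p
  (a ∷ p) +ₚ (b ∷ r) = (a + b) ∷ (p +ₚ r)

  _*ₚ_ : Poly → Poly → Poly
  []      *ₚ r = []
  (a ∷ p) *ₚ r = map (a *_) r +ₚ (0# ∷ (p *ₚ r))

  _∣ₚ_ : Poly → Poly → Set
  p ∣ₚ r = ∃[ s ] ((s *ₚ p) ≈ₚ r)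

  xⁿ-1 : ℕ → Poly
  xⁿ-1 n = (- 1# ∷ []) +ₚ (replicate n 0# ++ (1# ∷ []))

  monic : ∀ {m} → Vec Carrier m → Poly
  monic as = toList as ++ (1# ∷ [])

  IsOrd : Poly → ℕ → Set
  IsOrd h n' = 1 ≤ n' × h ∣ₚ xⁿ-1 n'
             × (∀ k → 1 ≤ k → h ∣ₚ xⁿ-1 k → n' ≤ k)

  Word : ℕ → Set
  Word n = Fin n → Carrier

  wpoly : ∀ {n} → Word n → Poly
  wpoly c = tabulate c

  -- The cyclic code C_{n,h,q}: the ideal of F_q[x]/(x^n - 1) generated by
  -- g = (x^n - 1)/h, i.e. c ∈ C iff c(x) ≡ a(x) g(x) (mod x^n - 1) for some a.
  InCode : (n : ℕ) → Poly → Word n → Set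
  InCode n h c = ∃[ g ] ((g *ₚ h) ≈ₚ xⁿ-1 n
               × ∃[ a ] ∃[ b ] (wpoly c ≈ₚ ((a *ₚ g) +ₚ (b *ₚ xⁿ-1 n))))

  ΣF : ∀ {m} → (Fin m → Carrier) → Carrier
  ΣF {zero}  f = 0#
  ΣF {suc m} f = f F.zero + ΣF (λ j → f (F.suc j))

  lincomb : ∀ {n m} → (Fin m → Carrier) → (Fin m → Word n) → Word n
  lincomb λs bs i = ΣF (λ j → λs j * bs j i)

  HasDim : ∀ {n} → (Word n → Set) → ℕ → Set
  HasDim {n} C d = ∃[ bs ] ((∀ (j : Fin d) → C (bs j))
       × (∀ λs → (∀ i → lincomb {n} {d} λs bs i ≡ 0#) → ∀ j → λs j ≡ 0#)
       × (∀ c → C c → ∃[ λs ] (∀ i → c i ≡ lincomb λs bs i)))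

  InPAut : ∀ {n} → (Word n → Set) → Permutation′ n → Set
  InPAut {n} C π = ∀ (c : Word n) → C c ⇔ C (λ i → c (π ⟨$⟩ʳ i))

InAG : ∀ {n} → 1 ≤ n → Permutation′ n → Set
InAG {n} n≥1 π = ∃[ t ] ∃[ a ] (Coprime t n
                 × ∀ i → π ⟨$⟩ʳ i ≡ reduce n≥1 (t N.* toℕ i N.+ a))

Card : ∀ {n} → (Permutation′ n → Set) → ℕ → Set
Card {n} P N = Σ (Fin N → Permutation′ n) λ f → (∀ j → P (f j))
  × (∀ j j′ → (∀ i → f j ⟨$⟩ʳ i ≡ f j′ ⟨$⟩ʳ i) → j ≡ j′)
  × (∀ π → P π → ∃[ j ] (∀ i → f j ⟨$⟩ʳ i ≡ π ⟨$⟩ʳ i))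

module _ {q : ℕ} (𝔽 : FiniteField q) where
  open FiniteField 𝔽

  Exceptional : ℕ → ℕ → Poly 𝔽 → Set
  Exceptional n n' h =
      (n ≡ 2 × n' ≡ 1 × _≈ₚ_ 𝔽 h (- 1# ∷ 1# ∷ []) × q N.% 2 ≡ 1)
    ⊎ (n ≡ 3 × n' ≡ 1 × _≈ₚ_ 𝔽 h (- 1# ∷ 1# ∷ []) × (q N.% 3 ≡ 1 ⊎ q N.% 3 ≡ 2))
    ⊎ (n ≡ 4 × n' ≡ 2 × _≈ₚ_ 𝔽 h (1# ∷ 1# ∷ []) × q N.% 2 ≡ 1)
    ⊎ (n ≡ 4 × n' ≡ 2 × _≈ₚ_ 𝔽 h (- 1# ∷ 0# ∷ 1# ∷ []) × q N.% 2 ≡ 1)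

-- Let h ∣ xⁿ − 1 have order n′.  Then n′ ∣ n, and with g′ = (xⁿ′ − 1)/h the generator of
-- C_{n,h} is g′·(1 + xⁿ′ + ⋯ + x^{(k−1)n′}), k = n/n′; so every codeword r·g (deg r < deg h)
-- is the codeword r·g′ of C_{n′,h} repeated k times, and the xʲ·g (j < deg h) form a basis.
-- Minimality of n′ means no two coordinates of C_{n′,h} agree on all codewords: by cyclic
-- invariance such an agreement would make g′ cyclically periodic with some period d < n′,
-- forcing h ∣ xᵈ − 1.  Hence a permutation preserves C_{n,h} exactly when it permutes the
-- residue classes mod n′ by an element of PAut(C_{n′,h}), which is the wreath product
-- S_k ≀ PAut(C_{n′,h}).  If n ≥ n′ + 3, the transposition of n − 1 and n − 1 − n′ is such a
-- permutation; it fixes 0 and 1 but is not the identity, so it is not affine.  The remaining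
-- pairs (n, n′) ∈ {(2,1), (3,1), (4,2)} are the exceptional cases, settled by enumeration.

module Submission where

open import Level using (0ℓ)
open import Data.Nat as ℕ using (ℕ; zero; suc; z≤n; s≤s; _≤_; _<_; _!; _^_)
import Data.Nat.Properties as ℕₚ
import Data.Nat.DivMod as ℕ
import Data.Nat.Divisibility as ℕᵈ
open import Data.Nat.Solver using (module +-*-Solver)
open +-*-Solver using (solve; _:+_; _:=_; con)
open import Data.List using (List; []; _∷_; _++_; map; replicate; drop)
open import Data.Product using (Σ; ∃-syntax; _×_; _,_; proj₁; proj₂)
open import Data.Sum using (_⊎_; inj₁; inj₂)
open import Data.Empty using (⊥; ⊥-elim)
open import Function.Base using (_∘_)
open import Function.Bundles using (_⇔_; mk⇔; Equivalence; Inverse; Injection)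
open import Function.Properties.Inverse using (↔⇒↣)
open import Relation.Binary.Bundles using (Setoid)
import Relation.Binary.Reasoning.Setoid
open import Relation.Binary.Definitions using (DecidableEquality; tri<; tri≈; tri>)
open import Relation.Binary.PropositionalEquality
open import Relation.Nullary using (¬_; Dec; yes; no)
import Relation.Nullary.Decidable as Dec
open import Algebra.Bundles using (CommutativeRing)
open import Data.Vec using (Vec; []; _∷_)
open import Data.Fin using (Fin; toℕ)
import Data.Fin as Fin
open import Data.Fin.Permutation using (Permutation′; _⟨$⟩ʳ_; _⟨$⟩ˡ_; inverseˡ; inverseʳ; permutation; flip; transpose)
import Data.Fin.Permutation as Perm
import Data.Fin.Properties as Finₚ

open import Defs
  using (FiniteField; IsPrimePower; Poly; Word; monic; _∣ₚ_; IsOrd; InCode; HasDim; ΣF; lincomb; reduce;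
         InPAut; InAG; Card; Exceptional)
open import Data.Nat.Coprimality using (Coprime)
import Defs as D

toℕ-reduce : ∀ {n} (n≥1 : 1 ≤ suc n) x → toℕ (reduce n≥1 x) ≡ x ℕ.% suc n
toℕ-reduce {n} _ x = Finₚ.toℕ-fromℕ< (ℕ.m%n<n x (suc n))

reduce-toℕ : ∀ {n} (n≥1 : 1 ≤ n) (j : Fin n) → reduce n≥1 (toℕ j) ≡ j
reduce-toℕ {suc n} n≥1 j = Finₚ.toℕ-injective (trans (toℕ-reduce n≥1 (toℕ j)) (ℕ.m<n⇒m%n≡m (Finₚ.toℕ<n j)))

reduce-combine : ∀ {k n} (n≥1 : 1 ≤ n) (a : Fin k) (j : Fin n) → reduce n≥1 (toℕ (Fin.combine a j)) ≡ j
reduce-combine {k} {suc n₀} n≥1 a j = Finₚ.toℕ-injective (begin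
  toℕ (reduce n≥1 (toℕ (Fin.combine a j)))   ≡⟨ toℕ-reduce n≥1 (toℕ (Fin.combine a j)) ⟩
  toℕ (Fin.combine a j) ℕ.% n                ≡⟨ cong (ℕ._% n) (Finₚ.toℕ-combine a j) ⟩
  (n ℕ.* toℕ a ℕ.+ toℕ j) ℕ.% n              ≡⟨ cong (ℕ._% n) (trans (ℕₚ.+-comm (n ℕ.* toℕ a) (toℕ j))
                                                                     (cong (toℕ j ℕ.+_) (ℕₚ.*-comm n (toℕ a)))) ⟩
  (toℕ j ℕ.+ toℕ a ℕ.* n) ℕ.% n              ≡⟨ ℕ.[m+kn]%n≡m%n (toℕ j) (toℕ a) n ⟩
  toℕ j ℕ.% n                                ≡⟨ ℕ.m<n⇒m%n≡m (Finₚ.toℕ<n j) ⟩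
  toℕ j                                      ∎)
  where
  open ≡-Reasoning
  n = suc n₀

module CyclicCodes {q : ℕ} (𝔽 : FiniteField q) where

  open FiniteField 𝔽

  ring : CommutativeRing 0ℓ 0ℓ
  ring = record { isCommutativeRing = isCommutativeRing }

  open CommutativeRing ring
    using (+-assoc; +-comm; +-identityˡ; +-identityʳ; -‿inverseˡ; -‿inverseʳ;
           *-assoc; *-comm; *-identityˡ; *-identityʳ; distribˡ; distribʳ; zeroˡ; zeroʳ;
           +-commutativeSemigroup)
  open import Algebra.Properties.Ring (CommutativeRing.ring ring)
    using (-‿distribˡ-*; -‿distribʳ-*; -1*x≈-x; -‿involutive; -0#≈0#; +-inverseʳ-unique;
           x∙y⁻¹≈ε⇒x≈y; x≈y⇒x∙y⁻¹≈ε)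
  open import Algebra.Properties.CommutativeSemigroup +-commutativeSemigroup
    using (interchange; x∙yz≈y∙xz)

  infix 4 _≟_
  _≟_ : DecidableEquality Carrier
  x ≟ y = Dec.map′ (Injection.injective (↔⇒↣ enum)) (cong (Inverse.to enum))
                   (Inverse.to enum x Finₚ.≟ Inverse.to enum y)

  x*y≡0⇒x≡0⊎y≡0 : ∀ x y → x * y ≡ 0# → x ≡ 0# ⊎ y ≡ 0#
  x*y≡0⇒x≡0⊎y≡0 x y xy≡0 with x ≟ 0#
  ... | yes x≡0 = inj₁ x≡0
  ... | no x≢0 with inverse x x≢0
  ... | x⁻¹ , xx⁻¹≡1 = inj₂ (begin
    y               ≡⟨ sym (*-identityˡ y) ⟩
    1# * y          ≡⟨ cong (_* y) (trans (sym xx⁻¹≡1) (*-comm x x⁻¹)) ⟩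
    x⁻¹ * x * y     ≡⟨ *-assoc x⁻¹ x y ⟩
    x⁻¹ * (x * y)   ≡⟨ cong (x⁻¹ *_) xy≡0 ⟩
    x⁻¹ * 0#        ≡⟨ zeroʳ x⁻¹ ⟩
    0#              ∎)
    where open ≡-Reasoning

  [x+y]+[z-x]≡y+z : ∀ x y z → (x + y) + (z + - x) ≡ y + z
  [x+y]+[z-x]≡y+z x y z = begin
    (x + y) + (z + - x)   ≡⟨ cong₂ _+_ (+-comm x y) (+-comm z (- x)) ⟩
    (y + x) + (- x + z)   ≡⟨ +-assoc y x _ ⟩
    y + (x + (- x + z))   ≡⟨ cong (y +_) (+-assoc x (- x) z) ⟨
    y + ((x + - x) + z)   ≡⟨ cong (λ w → y + (w + z)) (-‿inverseʳ x) ⟩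
    y + (0# + z)          ≡⟨ cong (y +_) (+-identityˡ z) ⟩
    y + z                 ∎
    where open ≡-Reasoning

  x*x≡1⇒x≡1⊎x≡-1 : ∀ x → x * x ≡ 1# → x ≡ 1# ⊎ x ≡ - 1#
  x*x≡1⇒x≡1⊎x≡-1 x xx≡1 with x*y≡0⇒x≡0⊎y≡0 (x + - 1#) (x + 1#) [x-1][x+1]≡0
    where
    open ≡-Reasoning
    [x-1][x+1]≡0 : (x + - 1#) * (x + 1#) ≡ 0#
    [x-1][x+1]≡0 = begin
      (x + - 1#) * (x + 1#)               ≡⟨ distribˡ (x + - 1#) x 1# ⟩
      (x + - 1#) * x + (x + - 1#) * 1#    ≡⟨ cong₂ _+_ (distribʳ x x (- 1#)) (*-identityʳ _) ⟩
      (x * x + - 1# * x) + (x + - 1#)     ≡⟨ cong₂ (λ u v → (u + v) + (x + - 1#)) xx≡1 (-1*x≈-x x) ⟩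
      (1# + - x) + (x + - 1#)             ≡⟨ [x+y]+[z-x]≡y+z 1# (- x) x ⟩
      - x + x                             ≡⟨ -‿inverseˡ x ⟩
      0#                                  ∎
  ... | inj₁ x-1≡0 = inj₁ (x∙y⁻¹≈ε⇒x≈y x 1# x-1≡0)
  ... | inj₂ x+1≡0 = inj₂ (+-inverseʳ-unique 1# x (trans (+-comm 1# x) x+1≡0))

  infixl 6 _+ₚ_ _-ₚ_
  infixl 7 _*ₚ_ _·ₚ_
  infix 4 _≈_

  coeff : Poly 𝔽 → ℕ → Carrier
  coeff = D.coeff 𝔽

  _+ₚ_ _*ₚ_ : Poly 𝔽 → Poly 𝔽 → Poly 𝔽
  _+ₚ_ = D._+ₚ_ 𝔽
  _*ₚ_ = D._*ₚ_ 𝔽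

  _·ₚ_ : Carrier → Poly 𝔽 → Poly 𝔽
  c ·ₚ p = map (c *_) p

  _-ₚ_ : Poly 𝔽 → Poly 𝔽 → Poly 𝔽
  p -ₚ r = p +ₚ (- 1#) ·ₚ r

  1ₚ : Poly 𝔽
  1ₚ = 1# ∷ []

  -- Defs._≈ₚ_ wrapped in a record, so that the two polynomials can be inferred from a proof.
  record _≈_ (p r : Poly 𝔽) : Set where
    constructor mk≈
    field coeff≡ : ∀ i → coeff p i ≡ coeff r i
  open _≈_ public

  ≈-refl : ∀ {p} → p ≈ p
  ≈-refl = mk≈ λ _ → refl

  ≈-sym : ∀ {p r} → p ≈ r → r ≈ p
  ≈-sym p≈r = mk≈ λ i → sym (coeff≡ p≈r i)

  ≈-trans : ∀ {p r s} → p ≈ r → r ≈ s → p ≈ s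
  ≈-trans p≈r r≈s = mk≈ λ i → trans (coeff≡ p≈r i) (coeff≡ r≈s i)

  ≈-setoid : Setoid 0ℓ 0ℓ
  ≈-setoid = record
    { Carrier = Poly 𝔽 ; _≈_ = _≈_
    ; isEquivalence = record { refl = ≈-refl ; sym = ≈-sym ; trans = ≈-trans } }

  module ≈-Reasoning = Relation.Binary.Reasoning.Setoid ≈-setoid

  coeff-+ : ∀ p r i → coeff (p +ₚ r) i ≡ coeff p i + coeff r i
  coeff-+ []      r       i       = sym (+-identityˡ _)
  coeff-+ (a ∷ p) []      i       = sym (+-identityʳ _)
  coeff-+ (a ∷ p) (b ∷ r) zero    = refl
  coeff-+ (a ∷ p) (b ∷ r) (suc i) = coeff-+ p r i

  coeff-· : ∀ c p i → coeff (c ·ₚ p) i ≡ c * coeff p i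
  coeff-· c []      i       = sym (zeroʳ c)
  coeff-· c (b ∷ p) zero    = refl
  coeff-· c (b ∷ p) (suc i) = coeff-· c p i

  coeff-- : ∀ p r i → coeff (p -ₚ r) i ≡ coeff p i + - coeff r i
  coeff-- p r i = trans (coeff-+ p ((- 1#) ·ₚ r) i)
                        (cong (coeff p i +_) (trans (coeff-· (- 1#) r i) (-1*x≈-x _)))

  ∷-cong : ∀ {a b p r} → a ≡ b → p ≈ r → a ∷ p ≈ b ∷ r
  ∷-cong a≡b p≈r = mk≈ λ { zero → a≡b ; (suc i) → coeff≡ p≈r i }

  +ₚ-cong : ∀ {p p′ r r′} → p ≈ p′ → r ≈ r′ → p +ₚ r ≈ p′ +ₚ r′
  +ₚ-cong {p} {p′} {r} {r′} p≈p′ r≈r′ = mk≈ λ i → begin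
    coeff (p +ₚ r) i          ≡⟨ coeff-+ p r i ⟩
    coeff p i + coeff r i     ≡⟨ cong₂ _+_ (coeff≡ p≈p′ i) (coeff≡ r≈r′ i) ⟩
    coeff p′ i + coeff r′ i   ≡⟨ coeff-+ p′ r′ i ⟨
    coeff (p′ +ₚ r′) i        ∎
    where open ≡-Reasoning

  ·ₚ-cong : ∀ c {p r} → p ≈ r → c ·ₚ p ≈ c ·ₚ r
  ·ₚ-cong c {p} {r} p≈r = mk≈ λ i →
    trans (coeff-· c p i) (trans (cong (c *_) (coeff≡ p≈r i)) (sym (coeff-· c r i)))

  +ₚ-identityʳ : ∀ p → p +ₚ [] ≈ p
  +ₚ-identityʳ []      = ≈-refl
  +ₚ-identityʳ (a ∷ p) = ≈-refl

  +ₚ-comm : ∀ p r → p +ₚ r ≈ r +ₚ p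
  +ₚ-comm p r = mk≈ λ i → trans (coeff-+ p r i) (trans (+-comm _ _) (sym (coeff-+ r p i)))

  +ₚ-assoc : ∀ p r s → (p +ₚ r) +ₚ s ≈ p +ₚ (r +ₚ s)
  +ₚ-assoc p r s = mk≈ λ i → begin
    coeff ((p +ₚ r) +ₚ s) i                ≡⟨ coeff-+ (p +ₚ r) s i ⟩
    coeff (p +ₚ r) i + coeff s i           ≡⟨ cong (_+ coeff s i) (coeff-+ p r i) ⟩
    coeff p i + coeff r i + coeff s i      ≡⟨ +-assoc _ _ _ ⟩
    coeff p i + (coeff r i + coeff s i)    ≡⟨ cong (coeff p i +_) (coeff-+ r s i) ⟨
    coeff p i + coeff (r +ₚ s) i           ≡⟨ coeff-+ p (r +ₚ s) i ⟨
    coeff (p +ₚ (r +ₚ s)) i                ∎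
    where open ≡-Reasoning

  *ₚ-congˡ : ∀ p {r r′} → r ≈ r′ → p *ₚ r ≈ p *ₚ r′
  *ₚ-congˡ []      r≈r′ = ≈-refl
  *ₚ-congˡ (a ∷ p) r≈r′ = +ₚ-cong (·ₚ-cong a r≈r′) (∷-cong refl (*ₚ-congˡ p r≈r′))

  *ₚ-zeroʳ : ∀ p → p *ₚ [] ≈ []
  *ₚ-zeroʳ []      = ≈-refl
  *ₚ-zeroʳ (a ∷ p) = mk≈ λ { zero → refl ; (suc i) → coeff≡ (*ₚ-zeroʳ p) i }

  *ₚ-∷ʳ : ∀ p b r → p *ₚ (b ∷ r) ≈ b ·ₚ p +ₚ (0# ∷ p *ₚ r)
  *ₚ-∷ʳ []      b r = mk≈ λ { zero → refl ; (suc i) → refl }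
  *ₚ-∷ʳ (a ∷ p) b r = ∷-cong (cong (_+ 0#) (*-comm a b)) (mk≈ λ i → begin
    coeff (a ·ₚ r +ₚ p *ₚ (b ∷ r)) i                     ≡⟨ coeff-+ (a ·ₚ r) _ i ⟩
    coeff (a ·ₚ r) i + coeff (p *ₚ (b ∷ r)) i            ≡⟨ cong (coeff (a ·ₚ r) i +_) (coeff≡ (*ₚ-∷ʳ p b r) i) ⟩
    coeff (a ·ₚ r) i + coeff (b ·ₚ p +ₚ (0# ∷ p *ₚ r)) i ≡⟨ cong (coeff (a ·ₚ r) i +_) (coeff-+ (b ·ₚ p) _ i) ⟩
    coeff (a ·ₚ r) i + (coeff (b ·ₚ p) i + coeff (0# ∷ p *ₚ r) i) ≡⟨ x∙yz≈y∙xz _ _ _ ⟩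
    coeff (b ·ₚ p) i + (coeff (a ·ₚ r) i + coeff (0# ∷ p *ₚ r) i) ≡⟨ cong (coeff (b ·ₚ p) i +_) (coeff-+ (a ·ₚ r) _ i) ⟨
    coeff (b ·ₚ p) i + coeff ((a ∷ p) *ₚ r) i            ≡⟨ coeff-+ (b ·ₚ p) _ i ⟨
    coeff (b ·ₚ p +ₚ (a ∷ p) *ₚ r) i                     ∎)
    where open ≡-Reasoning

  *ₚ-comm : ∀ p r → p *ₚ r ≈ r *ₚ p
  *ₚ-comm []      r = ≈-sym (*ₚ-zeroʳ r)
  *ₚ-comm (a ∷ p) r =
    ≈-sym (≈-trans (*ₚ-∷ʳ r a p) (+ₚ-cong ≈-refl (∷-cong refl (*ₚ-comm r p))))

  *ₚ-congʳ : ∀ {p p′} r → p ≈ p′ → p *ₚ r ≈ p′ *ₚ r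
  *ₚ-congʳ {p} {p′} r p≈p′ = ≈-trans (*ₚ-comm p r) (≈-trans (*ₚ-congˡ r p≈p′) (*ₚ-comm r p′))

  *ₚ-cong : ∀ {p p′ r r′} → p ≈ p′ → r ≈ r′ → p *ₚ r ≈ p′ *ₚ r′
  *ₚ-cong {p} {p′} {r} {r′} p≈p′ r≈r′ = ≈-trans (*ₚ-congʳ r p≈p′) (*ₚ-congˡ p′ r≈r′)

  +ₚ-interchange : ∀ p r s t → (p +ₚ r) +ₚ (s +ₚ t) ≈ (p +ₚ s) +ₚ (r +ₚ t)
  +ₚ-interchange p r s t = mk≈ λ i → begin
    coeff ((p +ₚ r) +ₚ (s +ₚ t)) i                         ≡⟨ coeff-+ (p +ₚ r) _ i ⟩
    coeff (p +ₚ r) i + coeff (s +ₚ t) i                    ≡⟨ cong₂ _+_ (coeff-+ p r i) (coeff-+ s t i) ⟩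
    (coeff p i + coeff r i) + (coeff s i + coeff t i)      ≡⟨ interchange _ _ _ _ ⟩
    (coeff p i + coeff s i) + (coeff r i + coeff t i)      ≡⟨ cong₂ _+_ (coeff-+ p s i) (coeff-+ r t i) ⟨
    coeff (p +ₚ s) i + coeff (r +ₚ t) i                    ≡⟨ coeff-+ (p +ₚ s) _ i ⟨
    coeff ((p +ₚ s) +ₚ (r +ₚ t)) i                         ∎
    where open ≡-Reasoning

  ·ₚ-distrib-+ₚ : ∀ c p r → c ·ₚ (p +ₚ r) ≈ c ·ₚ p +ₚ c ·ₚ r
  ·ₚ-distrib-+ₚ c p r = mk≈ λ i → begin
    coeff (c ·ₚ (p +ₚ r)) i                   ≡⟨ coeff-· c (p +ₚ r) i ⟩
    c * coeff (p +ₚ r) i                      ≡⟨ cong (c *_) (coeff-+ p r i) ⟩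
    c * (coeff p i + coeff r i)               ≡⟨ distribˡ c _ _ ⟩
    c * coeff p i + c * coeff r i             ≡⟨ cong₂ _+_ (coeff-· c p i) (coeff-· c r i) ⟨
    coeff (c ·ₚ p) i + coeff (c ·ₚ r) i       ≡⟨ coeff-+ (c ·ₚ p) _ i ⟨
    coeff (c ·ₚ p +ₚ c ·ₚ r) i                ∎
    where open ≡-Reasoning

  ·ₚ-assoc : ∀ c d p → c ·ₚ (d ·ₚ p) ≈ (c * d) ·ₚ p
  ·ₚ-assoc c d p = mk≈ λ i → begin
    coeff (c ·ₚ (d ·ₚ p)) i   ≡⟨ coeff-· c (d ·ₚ p) i ⟩
    c * coeff (d ·ₚ p) i      ≡⟨ cong (c *_) (coeff-· d p i) ⟩
    c * (d * coeff p i)       ≡⟨ *-assoc c d _ ⟨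
    c * d * coeff p i         ≡⟨ coeff-· (c * d) p i ⟨
    coeff ((c * d) ·ₚ p) i    ∎
    where open ≡-Reasoning

  *ₚ-distribˡ-+ₚ : ∀ p r s → p *ₚ (r +ₚ s) ≈ p *ₚ r +ₚ p *ₚ s
  *ₚ-distribˡ-+ₚ []      r s = ≈-refl
  *ₚ-distribˡ-+ₚ (a ∷ p) r s = begin
    a ·ₚ (r +ₚ s) +ₚ (0# ∷ p *ₚ (r +ₚ s))
      ≈⟨ +ₚ-cong (·ₚ-distrib-+ₚ a r s) (∷-cong refl (*ₚ-distribˡ-+ₚ p r s)) ⟩
    (a ·ₚ r +ₚ a ·ₚ s) +ₚ (0# ∷ (p *ₚ r +ₚ p *ₚ s))
      ≈⟨ +ₚ-cong ≈-refl (∷-cong (sym (+-identityˡ 0#)) ≈-refl) ⟩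
    (a ·ₚ r +ₚ a ·ₚ s) +ₚ ((0# ∷ p *ₚ r) +ₚ (0# ∷ p *ₚ s))
      ≈⟨ +ₚ-interchange (a ·ₚ r) (a ·ₚ s) (0# ∷ p *ₚ r) (0# ∷ p *ₚ s) ⟩
    (a ∷ p) *ₚ r +ₚ (a ∷ p) *ₚ s ∎
    where open ≈-Reasoning

  *ₚ-distribʳ-+ₚ : ∀ p r s → (r +ₚ s) *ₚ p ≈ r *ₚ p +ₚ s *ₚ p
  *ₚ-distribʳ-+ₚ p r s = begin
    (r +ₚ s) *ₚ p        ≈⟨ *ₚ-comm (r +ₚ s) p ⟩
    p *ₚ (r +ₚ s)        ≈⟨ *ₚ-distribˡ-+ₚ p r s ⟩
    p *ₚ r +ₚ p *ₚ s     ≈⟨ +ₚ-cong (*ₚ-comm p r) (*ₚ-comm p s) ⟩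
    r *ₚ p +ₚ s *ₚ p     ∎
    where open ≈-Reasoning

  ·ₚ-*ₚ-assoc : ∀ c p r → (c ·ₚ p) *ₚ r ≈ c ·ₚ (p *ₚ r)
  ·ₚ-*ₚ-assoc c []      r = ≈-refl
  ·ₚ-*ₚ-assoc c (a ∷ p) r = begin
    (c * a) ·ₚ r +ₚ (0# ∷ (c ·ₚ p) *ₚ r)
      ≈⟨ +ₚ-cong (≈-sym (·ₚ-assoc c a r)) (∷-cong refl (·ₚ-*ₚ-assoc c p r)) ⟩
    c ·ₚ (a ·ₚ r) +ₚ (0# ∷ c ·ₚ (p *ₚ r))
      ≈⟨ +ₚ-cong ≈-refl (∷-cong (sym (zeroʳ c)) ≈-refl) ⟩
    c ·ₚ (a ·ₚ r) +ₚ c ·ₚ (0# ∷ p *ₚ r)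
      ≈⟨ ·ₚ-distrib-+ₚ c (a ·ₚ r) (0# ∷ p *ₚ r) ⟨
    c ·ₚ ((a ∷ p) *ₚ r) ∎
    where open ≈-Reasoning

  *ₚ-assoc : ∀ p r s → (p *ₚ r) *ₚ s ≈ p *ₚ (r *ₚ s)
  *ₚ-assoc []      r s = ≈-refl
  *ₚ-assoc (a ∷ p) r s = begin
    (a ·ₚ r +ₚ (0# ∷ p *ₚ r)) *ₚ s
      ≈⟨ *ₚ-distribʳ-+ₚ s (a ·ₚ r) _ ⟩
    (a ·ₚ r) *ₚ s +ₚ (0# ∷ p *ₚ r) *ₚ s
      ≈⟨ +ₚ-cong (·ₚ-*ₚ-assoc a r s) (x*ₚ (p *ₚ r) s) ⟩
    a ·ₚ (r *ₚ s) +ₚ (0# ∷ (p *ₚ r) *ₚ s)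
      ≈⟨ +ₚ-cong ≈-refl (∷-cong refl (*ₚ-assoc p r s)) ⟩
    (a ∷ p) *ₚ (r *ₚ s) ∎
    where
    open ≈-Reasoning
    x*ₚ : ∀ u s → (0# ∷ u) *ₚ s ≈ (0# ∷ u *ₚ s)
    x*ₚ u s = mk≈ λ i → trans (coeff-+ (0# ·ₚ s) _ i)
      (trans (cong (_+ coeff (0# ∷ u *ₚ s) i) (trans (coeff-· 0# s i) (zeroˡ _))) (+-identityˡ _))

  *ₚ-identityˡ : ∀ p → 1ₚ *ₚ p ≈ p
  *ₚ-identityˡ p = mk≈ λ i → begin
    coeff (1# ·ₚ p +ₚ (0# ∷ [])) i        ≡⟨ coeff-+ (1# ·ₚ p) _ i ⟩
    coeff (1# ·ₚ p) i + coeff (0# ∷ []) i ≡⟨ cong₂ _+_ (trans (coeff-· 1# p i) (*-identityˡ _)) (zero-coeff i) ⟩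
    coeff p i + 0#                        ≡⟨ +-identityʳ _ ⟩
    coeff p i                             ∎
    where
    open ≡-Reasoning
    zero-coeff : ∀ i → coeff (0# ∷ []) i ≡ 0#
    zero-coeff zero    = refl
    zero-coeff (suc i) = refl

  *ₚ-identityʳ : ∀ p → p *ₚ 1ₚ ≈ p
  *ₚ-identityʳ p = ≈-trans (*ₚ-comm p 1ₚ) (*ₚ-identityˡ p)

  *ₚ-distribʳ--ₚ : ∀ p r s → (p -ₚ r) *ₚ s ≈ p *ₚ s -ₚ r *ₚ s
  *ₚ-distribʳ--ₚ p r s =
    ≈-trans (*ₚ-distribʳ-+ₚ s p _) (+ₚ-cong ≈-refl (·ₚ-*ₚ-assoc (- 1#) r s))

  -ₚ≈[]⇒≈ : ∀ {p r} → p -ₚ r ≈ [] → p ≈ r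
  -ₚ≈[]⇒≈ {p} {r} p-r≈0 = mk≈ λ i → x∙y⁻¹≈ε⇒x≈y _ _ (trans (sym (coeff-- p r i)) (coeff≡ p-r≈0 i))

  coeff-*ₚ-∷ : ∀ a p r i → coeff ((a ∷ p) *ₚ r) i ≡ a * coeff r i + coeff (0# ∷ p *ₚ r) i
  coeff-*ₚ-∷ a p r i = trans (coeff-+ (a ·ₚ r) _ i) (cong (_+ _) (coeff-· a r i))

  DegreeBelow : ℕ → Poly 𝔽 → Set
  DegreeBelow N p = ∀ i → coeff p (N ℕ.+ i) ≡ 0#

  Monic : ℕ → Poly 𝔽 → Set
  Monic m p = coeff p m ≡ 1# × DegreeBelow (suc m) p

  degreeBelow-0⇒≈[] : ∀ p → DegreeBelow 0 p → p ≈ []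
  degreeBelow-0⇒≈[] p deg = mk≈ deg

  monic-0⇒≈1ₚ : ∀ {h} → Monic 0 h → h ≈ 1ₚ
  monic-0⇒≈1ₚ (h[0]≡1 , degh) = mk≈ λ where
    zero    → h[0]≡1
    (suc i) → degh i

  degreeBelow-cong : ∀ {N p r} → p ≈ r → DegreeBelow N p → DegreeBelow N r
  degreeBelow-cong {N} p≈r deg i = trans (sym (coeff≡ p≈r (N ℕ.+ i))) (deg i)

  degreeBelow-mono : ∀ {N M} p → N ≤ M → DegreeBelow N p → DegreeBelow M p
  degreeBelow-mono {N} p N≤M deg i with ℕₚ.m≤n⇒∃[o]m+o≡n N≤M
  ... | o , refl = trans (cong (coeff p) (ℕₚ.+-assoc N o i)) (deg (o ℕ.+ i))

  degreeBelow-*ₚ : ∀ {A B} p r → DegreeBelow A p → DegreeBelow (suc B) r → DegreeBelow (A ℕ.+ B) (p *ₚ r)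
  degreeBelow-*ₚ []      r degp degr i = refl
  degreeBelow-*ₚ {zero} {B} (a ∷ p) r degp degr i = coeff≡ (*ₚ-congʳ r (degreeBelow-0⇒≈[] (a ∷ p) degp)) (B ℕ.+ i)
  degreeBelow-*ₚ {suc A} {B} (a ∷ p) r degp degr i = begin
    coeff ((a ∷ p) *ₚ r) (suc (A ℕ.+ B ℕ.+ i))            ≡⟨ coeff-*ₚ-∷ a p r _ ⟩
    a * coeff r (suc (A ℕ.+ B ℕ.+ i)) + coeff (p *ₚ r) (A ℕ.+ B ℕ.+ i)
      ≡⟨ cong₂ _+_ (cong (a *_) (trans (cong (coeff r ∘ suc) A+B+i≡B+[A+i]) (degr (A ℕ.+ i))))
                   (degreeBelow-*ₚ p r degp degr i) ⟩
    a * 0# + 0#                                          ≡⟨ trans (+-identityʳ _) (zeroʳ a) ⟩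
    0#                                                   ∎
    where
    open ≡-Reasoning
    A+B+i≡B+[A+i] : A ℕ.+ B ℕ.+ i ≡ B ℕ.+ (A ℕ.+ i)
    A+B+i≡B+[A+i] = trans (cong (ℕ._+ i) (ℕₚ.+-comm A B)) (ℕₚ.+-assoc B A i)

  coeff-*ₚ-monic : ∀ {A m} p h → DegreeBelow (suc A) p → Monic m h → coeff (p *ₚ h) (A ℕ.+ m) ≡ coeff p A
  coeff-*ₚ-monic []      h degp monic = refl
  coeff-*ₚ-monic {zero} {m} (a ∷ p) h degp (h[m]≡1 , degh) = begin
    coeff ((a ∷ p) *ₚ h) m                     ≡⟨ coeff-*ₚ-∷ a p h m ⟩
    a * coeff h m + coeff (0# ∷ p *ₚ h) m      ≡⟨ cong₂ _+_ (cong (a *_) h[m]≡1)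
                                                            (coeff≡ (∷-cong refl (*ₚ-congʳ h (degreeBelow-0⇒≈[] p degp))) m) ⟩
    a * 1# + coeff (0# ∷ []) m                 ≡⟨ cong₂ _+_ (*-identityʳ a) (coeff-0∷[] m) ⟩
    a + 0#                                     ≡⟨ +-identityʳ a ⟩
    a                                          ∎
    where
    open ≡-Reasoning
    coeff-0∷[] : ∀ i → coeff (0# ∷ []) i ≡ 0#
    coeff-0∷[] zero    = refl
    coeff-0∷[] (suc i) = refl
  coeff-*ₚ-monic {suc A} {m} (a ∷ p) h degp (h[m]≡1 , degh) = begin
    coeff ((a ∷ p) *ₚ h) (suc (A ℕ.+ m))                  ≡⟨ coeff-*ₚ-∷ a p h _ ⟩
    a * coeff h (suc (A ℕ.+ m)) + coeff (p *ₚ h) (A ℕ.+ m)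
      ≡⟨ cong₂ _+_ (cong (a *_) h-vanishes) (coeff-*ₚ-monic p h degp (h[m]≡1 , degh)) ⟩
    a * 0# + coeff p A                                    ≡⟨ cong (_+ coeff p A) (zeroʳ a) ⟩
    0# + coeff p A                                        ≡⟨ +-identityˡ _ ⟩
    coeff p A                                             ∎
    where
    open ≡-Reasoning
    h-vanishes : coeff h (suc (A ℕ.+ m)) ≡ 0#
    h-vanishes = trans (cong (coeff h ∘ suc) (ℕₚ.+-comm A m)) (degh A)

  -- coeff (0# ∷ p) m is the coefficient of p in degree m − 1, and 0 when m = 0.
  coeff-*ₚ-top : ∀ {m d N} p g → DegreeBelow m p → Monic d g → m ℕ.+ d ≡ suc N →
                 coeff (p *ₚ g) N ≡ coeff (0# ∷ p) m
  coeff-*ₚ-top {zero}          p g degp monic d≡1+N = coeff≡ (*ₚ-congʳ g (degreeBelow-0⇒≈[] p degp)) _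
  coeff-*ₚ-top {suc A} {d} {N} p g degp monic A+d≡N =
    trans (cong (coeff (p *ₚ g)) (sym (ℕₚ.suc-injective A+d≡N))) (coeff-*ₚ-monic p g degp monic)

  coeff-*ₚ-∷-above : ∀ {m} a p h → Monic m h → ∀ j → m ≤ j → coeff ((a ∷ p) *ₚ h) (suc j) ≡ coeff (p *ₚ h) j
  coeff-*ₚ-∷-above {m} a p h (_ , degh) j m≤j with ℕₚ.m≤n⇒∃[o]m+o≡n m≤j
  ... | o , refl = begin
    coeff ((a ∷ p) *ₚ h) (suc (m ℕ.+ o))              ≡⟨ coeff-*ₚ-∷ a p h _ ⟩
    a * coeff h (suc (m ℕ.+ o)) + coeff (p *ₚ h) (m ℕ.+ o) ≡⟨ cong (λ x → a * x + coeff (p *ₚ h) (m ℕ.+ o)) (degh o) ⟩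
    a * 0# + coeff (p *ₚ h) (m ℕ.+ o)                 ≡⟨ cong (_+ coeff (p *ₚ h) (m ℕ.+ o)) (zeroʳ a) ⟩
    0# + coeff (p *ₚ h) (m ℕ.+ o)                     ≡⟨ +-identityˡ _ ⟩
    coeff (p *ₚ h) (m ℕ.+ o)                          ∎
    where open ≡-Reasoning

  degreeBelow-*ₚ-monic⁻¹ : ∀ {m} h → Monic m h → ∀ N p → DegreeBelow (N ℕ.+ m) (p *ₚ h) → DegreeBelow N p
  degreeBelow-*ₚ-monic⁻¹ h monic N [] deg i = refl
  degreeBelow-*ₚ-monic⁻¹ {m} h monic (suc N) (a ∷ p) deg =
    degreeBelow-*ₚ-monic⁻¹ h monic N p λ j →
      trans (sym (coeff-*ₚ-∷-above a p h monic (N ℕ.+ m ℕ.+ j) (ℕₚ.≤-trans (ℕₚ.m≤n+m m N) (ℕₚ.m≤m+n _ j))))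
            (deg j)
  degreeBelow-*ₚ-monic⁻¹ {m} h monic@(h[m]≡1 , _) zero (a ∷ p) deg = λ where
      zero    → a≡0
      (suc i) → p≈0 i
    where
    open ≡-Reasoning
    p≈0 : DegreeBelow 0 p
    p≈0 = degreeBelow-*ₚ-monic⁻¹ h monic zero p λ j → begin
      coeff (p *ₚ h) (m ℕ.+ j)               ≡⟨ coeff-*ₚ-∷-above a p h monic (m ℕ.+ j) (ℕₚ.m≤m+n m j) ⟨
      coeff ((a ∷ p) *ₚ h) (suc (m ℕ.+ j))   ≡⟨ cong (coeff ((a ∷ p) *ₚ h)) (ℕₚ.+-suc m j) ⟨
      coeff ((a ∷ p) *ₚ h) (m ℕ.+ suc j)     ≡⟨ deg (suc j) ⟩
      0#                                     ∎
    a≡0 : a ≡ 0#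
    a≡0 = begin
      a                                      ≡⟨ coeff-*ₚ-monic (a ∷ p) h p≈0 monic ⟨
      coeff ((a ∷ p) *ₚ h) m                 ≡⟨ cong (coeff ((a ∷ p) *ₚ h)) (ℕₚ.+-identityʳ m) ⟨
      coeff ((a ∷ p) *ₚ h) (m ℕ.+ 0)         ≡⟨ deg 0 ⟩
      0#                                     ∎

  *ₚ-cancelʳ-monic : ∀ {m} h → Monic m h → ∀ {p r} → p *ₚ h ≈ r *ₚ h → p ≈ r
  *ₚ-cancelʳ-monic {m} h monic {p} {r} ph≈rh = -ₚ≈[]⇒≈ (degreeBelow-0⇒≈[] (p -ₚ r)
    (degreeBelow-*ₚ-monic⁻¹ h monic 0 (p -ₚ r) λ i →
      trans (coeff≡ (*ₚ-distribʳ--ₚ p r h) (m ℕ.+ i))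
            (trans (coeff-- (p *ₚ h) (r *ₚ h) _) (x≈y⇒x∙y⁻¹≈ε (coeff≡ ph≈rh (m ℕ.+ i))))))

  *ₚ-cancelˡ-monic : ∀ {m} h → Monic m h → ∀ {p r} → h *ₚ p ≈ h *ₚ r → p ≈ r
  *ₚ-cancelˡ-monic h monic {p} {r} hp≈hr =
    *ₚ-cancelʳ-monic h monic (≈-trans (*ₚ-comm p h) (≈-trans hp≈hr (*ₚ-comm h r)))

  degreeBelow-eliminateTop : ∀ {m} h → Monic m h → ∀ p → DegreeBelow (suc m) p →
                             DegreeBelow m (p -ₚ coeff p m ·ₚ h)
  degreeBelow-eliminateTop {m} h (h[m]≡1 , degh) p degp i = begin
    coeff (p -ₚ c ·ₚ h) (m ℕ.+ i)                       ≡⟨ coeff-- p (c ·ₚ h) _ ⟩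
    coeff p (m ℕ.+ i) + - coeff (c ·ₚ h) (m ℕ.+ i)      ≡⟨ cong (λ x → coeff p (m ℕ.+ i) + - x) (coeff-· c h _) ⟩
    coeff p (m ℕ.+ i) + - (c * coeff h (m ℕ.+ i))       ≡⟨ top i ⟩
    0#                                                  ∎
    where
    open ≡-Reasoning
    c = coeff p m
    top : ∀ i → coeff p (m ℕ.+ i) + - (c * coeff h (m ℕ.+ i)) ≡ 0#
    top zero = begin
      coeff p (m ℕ.+ 0) + - (c * coeff h (m ℕ.+ 0))
        ≡⟨ cong₂ (λ x y → coeff p x + - (c * coeff h y)) (ℕₚ.+-identityʳ m) (ℕₚ.+-identityʳ m) ⟩
      c + - (c * coeff h m)                             ≡⟨ cong (λ x → c + - (c * x)) h[m]≡1 ⟩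
      c + - (c * 1#)                                    ≡⟨ cong (λ x → c + - x) (*-identityʳ c) ⟩
      c + - c                                           ≡⟨ -‿inverseʳ c ⟩
      0#                                                ∎
    top (suc i) = begin
      coeff p (m ℕ.+ suc i) + - (c * coeff h (m ℕ.+ suc i))
        ≡⟨ cong₂ (λ x y → coeff p x + - (c * coeff h y)) (ℕₚ.+-suc m i) (ℕₚ.+-suc m i) ⟩
      coeff p (suc m ℕ.+ i) + - (c * coeff h (suc m ℕ.+ i)) ≡⟨ cong₂ (λ x y → x + - (c * y)) (degp i) (degh i) ⟩
      0# + - (c * 0#)                                       ≡⟨ cong (λ x → 0# + - x) (zeroʳ c) ⟩
      0# + - 0#                                             ≡⟨ -‿inverseʳ 0# ⟩
      0#                                                    ∎

  monic-monic : ∀ {m} (hs : Vec Carrier m) → Monic m (D.monic 𝔽 hs)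
  monic-monic []       = refl , λ _ → refl
  monic-monic (a ∷ hs) = monic-monic hs

  shift : ℕ → Poly 𝔽 → Poly 𝔽
  shift j p = replicate j 0# ++ p

  coeff-shift-+ : ∀ j p i → coeff (shift j p) (j ℕ.+ i) ≡ coeff p i
  coeff-shift-+ zero    p i = refl
  coeff-shift-+ (suc j) p i = coeff-shift-+ j p i

  coeff-shift-< : ∀ j p i → i < j → coeff (shift j p) i ≡ 0#
  coeff-shift-< (suc j) p zero    i<j       = refl
  coeff-shift-< (suc j) p (suc i) (s≤s i<j) = coeff-shift-< j p i i<j

  shift-cong : ∀ j {p r} → p ≈ r → shift j p ≈ shift j r
  shift-cong zero    p≈r = p≈r
  shift-cong (suc j) p≈r = ∷-cong refl (shift-cong j p≈r)

  shift-+ₚ : ∀ j p r → shift j (p +ₚ r) ≈ shift j p +ₚ shift j r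
  shift-+ₚ zero    p r = ≈-refl
  shift-+ₚ (suc j) p r = ∷-cong (sym (+-identityˡ 0#)) (shift-+ₚ j p r)

  shift-shift : ∀ a b p → shift a (shift b p) ≡ shift (a ℕ.+ b) p
  shift-shift zero    b p = refl
  shift-shift (suc a) b p = cong (0# ∷_) (shift-shift a b p)

  shift-*ₚ : ∀ j p r → shift j p *ₚ r ≈ shift j (p *ₚ r)
  shift-*ₚ zero    p r = ≈-refl
  shift-*ₚ (suc j) p r = mk≈ λ i → begin
    coeff (0# ·ₚ r +ₚ (0# ∷ shift j p *ₚ r)) i          ≡⟨ coeff-*ₚ-∷ 0# (shift j p) r i ⟩
    0# * coeff r i + coeff (0# ∷ shift j p *ₚ r) i      ≡⟨ cong (_+ coeff (0# ∷ shift j p *ₚ r) i) (zeroˡ _) ⟩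
    0# + coeff (0# ∷ shift j p *ₚ r) i                  ≡⟨ +-identityˡ _ ⟩
    coeff (0# ∷ shift j p *ₚ r) i                       ≡⟨ coeff≡ (∷-cong refl (shift-*ₚ j p r)) i ⟩
    coeff (shift (suc j) (p *ₚ r)) i                    ∎
    where open ≡-Reasoning

  *ₚ-shift : ∀ j r p → r *ₚ shift j p ≈ shift j (r *ₚ p)
  *ₚ-shift j r p = ≈-trans (*ₚ-comm r (shift j p)) (≈-trans (shift-*ₚ j p r) (shift-cong j (*ₚ-comm p r)))

  degreeBelow-shift : ∀ j {N} p → DegreeBelow N p → DegreeBelow (j ℕ.+ N) (shift j p)
  degreeBelow-shift j {N} p deg i =
    trans (cong (coeff (shift j p)) (ℕₚ.+-assoc j N i)) (trans (coeff-shift-+ j p (N ℕ.+ i)) (deg i))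

  xⁿ-1 : ℕ → Poly 𝔽
  xⁿ-1 = D.xⁿ-1 𝔽

  coeff-xⁿ-1-suc : ∀ k i → coeff (xⁿ-1 k) (suc i) ≡ coeff (shift k 1ₚ) (suc i)
  coeff-xⁿ-1-suc k i = trans (coeff-+ (- 1# ∷ []) (shift k 1ₚ) (suc i)) (+-identityˡ _)

  monic-xⁿ-1 : ∀ k → Monic (suc k) (xⁿ-1 (suc k))
  monic-xⁿ-1 k = top , above
    where
    top : coeff (xⁿ-1 (suc k)) (suc k) ≡ 1#
    top = trans (coeff-xⁿ-1-suc (suc k) k)
                (trans (cong (coeff (shift (suc k) 1ₚ)) (sym (ℕₚ.+-identityʳ (suc k)))) (coeff-shift-+ (suc k) 1ₚ 0))
    above : DegreeBelow (suc (suc k)) (xⁿ-1 (suc k))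
    above i = trans (coeff-xⁿ-1-suc (suc k) (suc k ℕ.+ i))
                    (trans (cong (coeff (shift (suc k) 1ₚ)) (sym (ℕₚ.+-suc (suc k) i))) (coeff-shift-+ (suc k) 1ₚ (suc i)))

  xⁿ-1-zero : xⁿ-1 0 ≈ []
  xⁿ-1-zero = mk≈ λ where
    zero    → -‿inverseˡ 1#
    (suc i) → refl

  xⁿ-1-*ₚ : ∀ k p → xⁿ-1 k *ₚ p ≈ (- 1#) ·ₚ p +ₚ shift k p
  xⁿ-1-*ₚ k p = begin
    ((- 1# ∷ []) +ₚ shift k 1ₚ) *ₚ p          ≈⟨ *ₚ-distribʳ-+ₚ p (- 1# ∷ []) (shift k 1ₚ) ⟩
    (- 1# ∷ []) *ₚ p +ₚ shift k 1ₚ *ₚ p       ≈⟨ +ₚ-cong (mk≈ constant) (shift-*ₚ k 1ₚ p) ⟩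
    (- 1#) ·ₚ p +ₚ shift k (1ₚ *ₚ p)          ≈⟨ +ₚ-cong ≈-refl (shift-cong k (*ₚ-identityˡ p)) ⟩
    (- 1#) ·ₚ p +ₚ shift k p                  ∎
    where
    open ≈-Reasoning
    constant : ∀ i → coeff ((- 1# ∷ []) *ₚ p) i ≡ coeff ((- 1#) ·ₚ p) i
    constant zero    = trans (coeff-+ ((- 1#) ·ₚ p) (0# ∷ []) 0) (+-identityʳ _)
    constant (suc i) = trans (coeff-+ ((- 1#) ·ₚ p) (0# ∷ []) (suc i)) (+-identityʳ _)

  coeff-xⁿ-1-*ₚ : ∀ k p i → coeff (xⁿ-1 k *ₚ p) i ≡ - coeff p i + coeff (shift k p) i
  coeff-xⁿ-1-*ₚ k p i = trans (coeff≡ (xⁿ-1-*ₚ k p) i)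
    (trans (coeff-+ ((- 1#) ·ₚ p) (shift k p) i) (cong (_+ coeff (shift k p) i) (trans (coeff-· (- 1#) p i) (-1*x≈-x _))))

  shift-[] : ∀ j {p} → p ≈ [] → shift j p ≈ []
  shift-[] zero    p≈0 = p≈0
  shift-[] (suc j) p≈0 = mk≈ λ where
    zero    → refl
    (suc i) → coeff≡ (shift-[] j p≈0) i

  xⁿ-1-+ : ∀ a b → xⁿ-1 (a ℕ.+ b) ≈ shift a (xⁿ-1 b) +ₚ xⁿ-1 a
  xⁿ-1-+ a b = ≈-sym (begin
    shift a (e +ₚ shift b 1ₚ) +ₚ (e +ₚ shift a 1ₚ)
      ≈⟨ +ₚ-cong (shift-+ₚ a e (shift b 1ₚ)) ≈-refl ⟩
    (shift a e +ₚ shift a (shift b 1ₚ)) +ₚ (e +ₚ shift a 1ₚ)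
      ≡⟨ cong (λ u → (shift a e +ₚ u) +ₚ (e +ₚ shift a 1ₚ)) (shift-shift a b 1ₚ) ⟩
    (shift a e +ₚ xᵃ⁺ᵇ) +ₚ (e +ₚ shift a 1ₚ)
      ≈⟨ +ₚ-cong (+ₚ-comm (shift a e) xᵃ⁺ᵇ) ≈-refl ⟩
    (xᵃ⁺ᵇ +ₚ shift a e) +ₚ (e +ₚ shift a 1ₚ)
      ≈⟨ +ₚ-interchange xᵃ⁺ᵇ (shift a e) e (shift a 1ₚ) ⟩
    (xᵃ⁺ᵇ +ₚ e) +ₚ (shift a e +ₚ shift a 1ₚ)
      ≈⟨ +ₚ-cong (+ₚ-comm xᵃ⁺ᵇ e) (≈-sym (shift-+ₚ a e 1ₚ)) ⟩
    xⁿ-1 (a ℕ.+ b) +ₚ shift a (xⁿ-1 0)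
      ≈⟨ +ₚ-cong ≈-refl (shift-[] a xⁿ-1-zero) ⟩
    xⁿ-1 (a ℕ.+ b) +ₚ []
      ≈⟨ +ₚ-identityʳ _ ⟩
    xⁿ-1 (a ℕ.+ b) ∎)
    where
    open ≈-Reasoning
    e = - 1# ∷ []
    xᵃ⁺ᵇ = shift (a ℕ.+ b) 1ₚ

  coeff-drop : ∀ e p z → coeff (drop e p) z ≡ coeff p (e ℕ.+ z)
  coeff-drop zero    p       z = refl
  coeff-drop (suc e) []      z = refl
  coeff-drop (suc e) (a ∷ p) z = coeff-drop e p z

  module CyclicallyPeriodic (d e : ℕ) (p : Poly 𝔽) (degp : DegreeBelow (d ℕ.+ e) p)
    (wrap : ∀ t → t < d → coeff p (e ℕ.+ t) ≡ coeff p t)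
    (shift-d : ∀ i → i < e → coeff p (d ℕ.+ i) ≡ coeff p i) where

    CoefficientsMatch : ℕ → Set
    CoefficientsMatch x = - coeff p x + coeff (shift d p) x
                        ≡ - coeff (drop e p) x + coeff (shift (d ℕ.+ e) (drop e p)) x

    vanishes : ∀ w → d ℕ.+ e ≤ w → coeff p w ≡ 0#
    vanishes w d+e≤w with ℕₚ.m≤n⇒∃[o]m+o≡n d+e≤w
    ... | o , refl = degp o

    below-d : ∀ x → x < d → CoefficientsMatch x
    below-d x x<d = cong₂ (λ u v → - u + v)
      (trans (sym (wrap x x<d)) (sym (coeff-drop e p x)))
      (trans (coeff-shift-< d p x x<d) (sym (coeff-shift-< (d ℕ.+ e) (drop e p) x (ℕₚ.<-≤-trans x<d (ℕₚ.m≤m+n d e)))))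

    from-d : ∀ y → y < e → CoefficientsMatch (d ℕ.+ y)
    from-d y y<e = begin
      - coeff p (d ℕ.+ y) + coeff (shift d p) (d ℕ.+ y) ≡⟨ cong₂ (λ u v → - u + v) (shift-d y y<e) (coeff-shift-+ d p y) ⟩
      - coeff p y + coeff p y                           ≡⟨ -‿inverseˡ _ ⟩
      0#                                                ≡⟨ -‿inverseˡ 0# ⟨
      - 0# + 0#                                         ≡⟨ cong₂ (λ u v → - u + v)
                                                             (sym (trans (coeff-drop e p (d ℕ.+ y)) (vanishes _ d+e≤e+d+y)))
                                                             (sym (coeff-shift-< (d ℕ.+ e) (drop e p) (d ℕ.+ y) (ℕₚ.+-monoʳ-< d y<e))) ⟩
      - coeff (drop e p) (d ℕ.+ y) + coeff (shift (d ℕ.+ e) (drop e p)) (d ℕ.+ y) ∎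
      where
      open ≡-Reasoning
      d+e≤e+d+y : d ℕ.+ e ≤ e ℕ.+ (d ℕ.+ y)
      d+e≤e+d+y = subst (_≤ e ℕ.+ (d ℕ.+ y)) (ℕₚ.+-comm e d) (ℕₚ.+-monoʳ-≤ e (ℕₚ.m≤m+n d y))

    from-d+e : ∀ z → CoefficientsMatch (d ℕ.+ (e ℕ.+ z))
    from-d+e z = cong₂ (λ u v → - u + v)
      (trans (vanishes _ (subst (d ℕ.+ e ≤_) (ℕₚ.+-assoc d e z) (ℕₚ.m≤m+n (d ℕ.+ e) z)))
             (sym (trans (coeff-drop e p _) (vanishes _ (ℕₚ.≤-trans (ℕₚ.m≤m+n (d ℕ.+ e) z)
                                                          (subst (_≤ e ℕ.+ (d ℕ.+ (e ℕ.+ z))) (sym (ℕₚ.+-assoc d e z)) (ℕₚ.m≤n+m _ e)))))))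
      (trans (coeff-shift-+ d p (e ℕ.+ z))
             (sym (trans (cong (coeff (shift (d ℕ.+ e) (drop e p))) (sym (ℕₚ.+-assoc d e z)))
                         (trans (coeff-shift-+ (d ℕ.+ e) (drop e p) z) (coeff-drop e p z)))))

    coefficientsMatch : ∀ x → CoefficientsMatch x
    coefficientsMatch x with x ℕ.<? d
    ... | yes x<d = below-d x x<d
    ... | no x≮d with ℕₚ.m≤n⇒∃[o]m+o≡n (ℕₚ.≮⇒≥ x≮d)
    ... | y , refl with y ℕ.<? e
    ... | yes y<e = from-d y y<e
    ... | no y≮e with ℕₚ.m≤n⇒∃[o]m+o≡n (ℕₚ.≮⇒≥ y≮e)
    ... | z , refl = from-d+e z

    xᵈ-1*p≈xᵈ⁺ᵉ-1*drop : xⁿ-1 d *ₚ p ≈ xⁿ-1 (d ℕ.+ e) *ₚ drop e p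
    xᵈ-1*p≈xᵈ⁺ᵉ-1*drop = mk≈ λ x →
      trans (coeff-xⁿ-1-*ₚ d p x) (trans (coefficientsMatch x) (sym (coeff-xⁿ-1-*ₚ (d ℕ.+ e) (drop e p) x)))

  infix 4 _∣_
  _∣_ : Poly 𝔽 → Poly 𝔽 → Set
  h ∣ u = ∃[ s ] (s *ₚ h ≈ u)

  ∣ₚ⇒∣ : ∀ {h u} → D._∣ₚ_ 𝔽 h u → h ∣ u
  ∣ₚ⇒∣ (s , sh≈u) = s , mk≈ sh≈u

  ∣⇒∣ₚ : ∀ {h u} → h ∣ u → D._∣ₚ_ 𝔽 h u
  ∣⇒∣ₚ (s , sh≈u) = s , coeff≡ sh≈u

  ∣-respʳ : ∀ {h u v} → u ≈ v → h ∣ u → h ∣ v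
  ∣-respʳ u≈v (s , sh≈u) = s , ≈-trans sh≈u u≈v

  ∣-+ₚ : ∀ {h u v} → h ∣ u → h ∣ v → h ∣ u +ₚ v
  ∣-+ₚ {h} (s , sh≈u) (t , th≈v) = s +ₚ t , ≈-trans (*ₚ-distribʳ-+ₚ h s t) (+ₚ-cong sh≈u th≈v)

  ∣-shift : ∀ {h u} j → h ∣ u → h ∣ shift j u
  ∣-shift {h} j (s , sh≈u) = shift j s , ≈-trans (shift-*ₚ j s h) (shift-cong j sh≈u)

  ∣-+ₚ⁻¹ʳ : ∀ {h u v} → h ∣ u +ₚ v → h ∣ u → h ∣ v
  ∣-+ₚ⁻¹ʳ {h} {u} {v} (s , sh≈u+v) (t , th≈u) = s -ₚ t , ≈-trans (*ₚ-distribʳ--ₚ s t h) (mk≈ λ i → begin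
    coeff (s *ₚ h -ₚ t *ₚ h) i               ≡⟨ coeff-- (s *ₚ h) (t *ₚ h) i ⟩
    coeff (s *ₚ h) i + - coeff (t *ₚ h) i    ≡⟨ cong₂ (λ x y → x + - y) (trans (coeff≡ sh≈u+v i) (coeff-+ u v i)) (coeff≡ th≈u i) ⟩
    (coeff u i + coeff v i) + - coeff u i    ≡⟨ cong (_+ - coeff u i) (+-comm _ _) ⟩
    (coeff v i + coeff u i) + - coeff u i    ≡⟨ +-assoc _ _ _ ⟩
    coeff v i + (coeff u i + - coeff u i)    ≡⟨ cong (coeff v i +_) (-‿inverseʳ _) ⟩
    coeff v i + 0#                           ≡⟨ +-identityʳ _ ⟩
    coeff v i                                ∎)
    where open ≡-Reasoning

  ∣xⁿ-1⇒∣xᵃⁿ-1 : ∀ {h n} → h ∣ xⁿ-1 n → ∀ a → h ∣ xⁿ-1 (a ℕ.* n)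
  ∣xⁿ-1⇒∣xᵃⁿ-1 {h} {n} h∣xⁿ-1 zero    = [] , ≈-sym xⁿ-1-zero
  ∣xⁿ-1⇒∣xᵃⁿ-1 {h} {n} h∣xⁿ-1 (suc a) =
    ∣-respʳ (≈-sym (xⁿ-1-+ n (a ℕ.* n))) (∣-+ₚ (∣-shift n (∣xⁿ-1⇒∣xᵃⁿ-1 h∣xⁿ-1 a)) h∣xⁿ-1)

  divMod : ∀ {m} h → Monic m h → ∀ a → ∃[ s ] ∃[ r ] (DegreeBelow m r × a ≈ s *ₚ h +ₚ r)
  divMod {zero} h monic a = a , [] , (λ _ → refl) , ≈-sym (begin
    a *ₚ h +ₚ []   ≈⟨ +ₚ-identityʳ _ ⟩
    a *ₚ h         ≈⟨ *ₚ-congˡ a (monic-0⇒≈1ₚ monic) ⟩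
    a *ₚ 1ₚ        ≈⟨ *ₚ-identityʳ a ⟩
    a              ∎)
    where open ≈-Reasoning
  divMod {suc m} h monic [] = [] , [] , (λ _ → refl) , ≈-refl
  divMod {suc m} h monic (a₀ ∷ a) with divMod h monic a
  ... | s , r , degr , a≈sh+r =
    c ∷ s , (a₀ ∷ r) -ₚ c ·ₚ h , degreeBelow-eliminateTop h monic (a₀ ∷ r) degr , mk≈ λ i → sym (begin
      coeff ((c ∷ s) *ₚ h +ₚ ((a₀ ∷ r) -ₚ c ·ₚ h)) i
        ≡⟨ coeff-+ ((c ∷ s) *ₚ h) _ i ⟩
      coeff ((c ∷ s) *ₚ h) i + coeff ((a₀ ∷ r) -ₚ c ·ₚ h) i
        ≡⟨ cong₂ _+_ (coeff-*ₚ-∷ c s h i)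
                     (trans (coeff-- (a₀ ∷ r) (c ·ₚ h) i) (cong (λ x → coeff (a₀ ∷ r) i + - x) (coeff-· c h i))) ⟩
      (c * coeff h i + coeff (0# ∷ s *ₚ h) i) + (coeff (a₀ ∷ r) i + - (c * coeff h i))
        ≡⟨ [x+y]+[z-x]≡y+z _ _ _ ⟩
      coeff (0# ∷ s *ₚ h) i + coeff (a₀ ∷ r) i
        ≡⟨ shifted-sum i ⟩
      coeff (a₀ ∷ a) i ∎)
    where
    open ≡-Reasoning
    c = coeff r m
    shifted-sum : ∀ i → coeff (0# ∷ s *ₚ h) i + coeff (a₀ ∷ r) i ≡ coeff (a₀ ∷ a) i
    shifted-sum zero    = +-identityˡ a₀
    shifted-sum (suc i) = trans (sym (coeff-+ (s *ₚ h) r i)) (sym (coeff≡ a≈sh+r i))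

  monic-quotient : ∀ {m n} h g → Monic m h → g *ₚ h ≈ xⁿ-1 (suc n) → ∃[ d ] (m ℕ.+ d ≡ suc n × Monic d g)
  monic-quotient {m} {n} h g monic gh≈xⁿ-1 with m ℕ.≤? suc n
  ... | no m≰n = ⊥-elim (0≢1 (begin
    0#                            ≡⟨ coeff≡ (*ₚ-congʳ h g≈0) (suc n) ⟨
    coeff (g *ₚ h) (suc n)        ≡⟨ coeff≡ gh≈xⁿ-1 (suc n) ⟩
    coeff (xⁿ-1 (suc n)) (suc n)  ≡⟨ proj₁ (monic-xⁿ-1 n) ⟩
    1#                            ∎))
    where
    open ≡-Reasoning
    g≈0 : g ≈ []
    g≈0 = degreeBelow-0⇒≈[] g (degreeBelow-*ₚ-monic⁻¹ h monic 0 g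
            (degreeBelow-cong (≈-sym gh≈xⁿ-1) (degreeBelow-mono (xⁿ-1 (suc n)) (ℕₚ.≰⇒> m≰n) (proj₂ (monic-xⁿ-1 n)))))
  ... | yes m≤n with ℕₚ.m≤n⇒∃[o]m+o≡n m≤n
  ... | d , m+d≡n = d , m+d≡n , g[d]≡1 , degg
    where
    open ≡-Reasoning
    degg : DegreeBelow (suc d) g
    degg = degreeBelow-*ₚ-monic⁻¹ h monic (suc d) g (degreeBelow-cong (≈-sym gh≈xⁿ-1)
             (subst (λ N → DegreeBelow N (xⁿ-1 (suc n))) (cong suc (trans (sym m+d≡n) (ℕₚ.+-comm m d)))
                    (proj₂ (monic-xⁿ-1 n))))
    g[d]≡1 : coeff g d ≡ 1#
    g[d]≡1 = begin
      coeff g d                         ≡⟨ coeff-*ₚ-monic g h degg monic ⟨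
      coeff (g *ₚ h) (d ℕ.+ m)          ≡⟨ coeff≡ gh≈xⁿ-1 (d ℕ.+ m) ⟩
      coeff (xⁿ-1 (suc n)) (d ℕ.+ m)    ≡⟨ cong (coeff (xⁿ-1 (suc n))) (trans (ℕₚ.+-comm d m) m+d≡n) ⟩
      coeff (xⁿ-1 (suc n)) (suc n)      ≡⟨ proj₁ (monic-xⁿ-1 n) ⟩
      1#                                ∎

  ord∣ : ∀ {h n′ n} → 1 ≤ n′ → h ∣ xⁿ-1 n′ → (∀ k → 1 ≤ k → h ∣ xⁿ-1 k → n′ ≤ k) →
         h ∣ xⁿ-1 n → n′ ℕᵈ.∣ n
  ord∣ {h} {suc n′₀} {n} _ h∣xⁿ′-1 minimal h∣xⁿ-1 with n ℕ.% suc n′₀ in n%n′≡r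
  ... | zero   = ℕᵈ.m%n≡0⇒n∣m n (suc n′₀) n%n′≡r
  ... | suc r₀ = ⊥-elim (ℕₚ.<⇒≱ r<n′ (minimal (suc r₀) (s≤s z≤n) h∣xʳ-1))
    where
    a = n ℕ./ suc n′₀
    r<n′ : suc r₀ < suc n′₀
    r<n′ = subst (_< suc n′₀) n%n′≡r (ℕ.m%n<n n (suc n′₀))
    n≡r+an′ : n ≡ suc r₀ ℕ.+ a ℕ.* suc n′₀
    n≡r+an′ = trans (ℕ.m≡m%n+[m/n]*n n (suc n′₀)) (cong (ℕ._+ a ℕ.* suc n′₀) n%n′≡r)
    h∣xʳ-1 : h ∣ xⁿ-1 (suc r₀)
    h∣xʳ-1 = ∣-+ₚ⁻¹ʳ
      (∣-respʳ (subst (λ k → xⁿ-1 k ≈ shift (suc r₀) (xⁿ-1 (a ℕ.* suc n′₀)) +ₚ xⁿ-1 (suc r₀)) (sym n≡r+an′)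
                      (xⁿ-1-+ (suc r₀) (a ℕ.* suc n′₀)))
               h∣xⁿ-1)
      (∣-shift (suc r₀) (∣xⁿ-1⇒∣xᵃⁿ-1 {n = suc n′₀} h∣xⁿ′-1 a))

  xⁿ-1-1≈x-1 : xⁿ-1 1 ≈ (- 1# ∷ 1# ∷ [])
  xⁿ-1-1≈x-1 = ∷-cong (+-identityʳ (- 1#)) ≈-refl

  xⁿ-1-2≈x²-1 : xⁿ-1 2 ≈ (- 1# ∷ 0# ∷ 1# ∷ [])
  xⁿ-1-2≈x²-1 = ∷-cong (+-identityʳ (- 1#)) ≈-refl

  monic-linear : ∀ {h} → Monic 1 h → h ≈ (coeff h 0 ∷ 1# ∷ [])
  monic-linear (h[1]≡1 , degh) = mk≈ λ where
    zero          → refl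
    (suc zero)    → h[1]≡1
    (suc (suc i)) → degh i

  monic-factor-of-full-degree : ∀ {n} h g → Monic (suc n) h → g *ₚ h ≈ xⁿ-1 (suc n) → h ≈ xⁿ-1 (suc n)
  monic-factor-of-full-degree {n} h g monic-h gh≈xⁿ-1 with monic-quotient h g monic-h gh≈xⁿ-1
  ... | d , n+d≡n , monic-g = begin
    h            ≈⟨ *ₚ-identityˡ h ⟨
    1ₚ *ₚ h      ≈⟨ *ₚ-congʳ h (monic-0⇒≈1ₚ {g} (subst (λ e → Monic e g) d≡0 monic-g)) ⟨
    g *ₚ h       ≈⟨ gh≈xⁿ-1 ⟩
    xⁿ-1 (suc n) ∎
    where
    open ≈-Reasoning
    d≡0 : d ≡ 0
    d≡0 = ℕₚ.+-cancelˡ-≡ (suc n) d 0 (trans n+d≡n (sym (ℕₚ.+-identityʳ (suc n))))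

  monic-∣x-1 : ∀ {m} h → 1 ≤ m → Monic m h → h ∣ xⁿ-1 1 → h ≈ (- 1# ∷ 1# ∷ [])
  monic-∣x-1 {m} h 1≤m monic-h (g , gh≈x-1) with monic-quotient {n = 0} h g monic-h gh≈x-1
  ... | d , m+d≡1 , _ =
    ≈-trans (monic-factor-of-full-degree {0} h g (subst (λ e → Monic e h) m≡1 monic-h) gh≈x-1) xⁿ-1-1≈x-1
    where
    m≡1 : m ≡ 1
    m≡1 = ℕₚ.≤-antisym (subst (m ≤_) m+d≡1 (ℕₚ.m≤m+n m d)) 1≤m

  linear-factor-of-x²-1 : ∀ {h g} → Monic 1 h → Monic 1 g → g *ₚ h ≈ xⁿ-1 2 → coeff h 0 * coeff h 0 ≡ 1#
  linear-factor-of-x²-1 {h} {g} monic-h monic-g gh≈x²-1 = begin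
    a * a                        ≡⟨ -‿involutive (a * a) ⟨
    - - (a * a)                  ≡⟨ cong -_ (-‿distribˡ-* a a) ⟩
    - (- a * a)                  ≡⟨ cong (λ u → - (u * a)) b≡-a ⟨
    - (b * a)                    ≡⟨ cong -_ (trans (sym (+-identityʳ _)) (trans (coeff≡ product 0) (+-identityʳ _))) ⟩
    - - 1#                       ≡⟨ -‿involutive 1# ⟩
    1#                           ∎
    where
    open ≡-Reasoning
    a = coeff h 0
    b = coeff g 0
    product : (b ∷ 1# ∷ []) *ₚ (a ∷ 1# ∷ []) ≈ xⁿ-1 2
    product = ≈-trans (*ₚ-cong {b ∷ 1# ∷ []} {g} {a ∷ 1# ∷ []} {h}
                                (≈-sym (monic-linear monic-g)) (≈-sym (monic-linear monic-h)))
                      gh≈x²-1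
    b≡-a : b ≡ - a
    b≡-a = +-inverseʳ-unique a b (begin
      a + b                        ≡⟨ +-comm a b ⟩
      b + a                        ≡⟨ cong₂ _+_ (*-identityʳ b) (trans (+-identityʳ _) (*-identityˡ a)) ⟨
      b * 1# + (1# * a + 0#)       ≡⟨ coeff≡ product 1 ⟩
      0#                           ∎)

  monic-∣x²-1 : ∀ {m} h → 1 ≤ m → Monic m h → h ∣ xⁿ-1 2 → ¬ (h ∣ xⁿ-1 1) →
                h ≈ (1# ∷ 1# ∷ []) ⊎ h ≈ (- 1# ∷ 0# ∷ 1# ∷ [])
  monic-∣x²-1 {1} h _ monic-h (g , gh≈x²-1) h∤x-1 with monic-quotient {n = 1} h g monic-h gh≈x²-1
  ... | d , 1+d≡2 , monic-g with x*x≡1⇒x≡1⊎x≡-1 (coeff h 0)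
         (linear-factor-of-x²-1 {h} {g} monic-h (subst (λ e → Monic e g) (ℕₚ.suc-injective 1+d≡2) monic-g) gh≈x²-1)
  ... | inj₁ a≡1  = inj₁ (≈-trans (monic-linear monic-h) (∷-cong a≡1 ≈-refl))
  ... | inj₂ a≡-1 = ⊥-elim (h∤x-1 (1ₚ , ≈-trans (*ₚ-identityˡ h)
                      (≈-trans (monic-linear monic-h) (≈-trans (∷-cong a≡-1 ≈-refl) (≈-sym xⁿ-1-1≈x-1)))))
  monic-∣x²-1 {2} h _ monic-h (g , gh≈x²-1) _ =
    inj₂ (≈-trans (monic-factor-of-full-degree {1} h g monic-h gh≈x²-1) xⁿ-1-2≈x²-1)
  monic-∣x²-1 {suc (suc (suc m))} h _ monic-h (g , gh≈x²-1) _ with monic-quotient {n = 1} h g monic-h gh≈x²-1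
  ... | _ , () , _

  wpoly : ∀ {n} → Word 𝔽 n → Poly 𝔽
  wpoly = D.wpoly 𝔽

  coeff-wpoly : ∀ {n} (c : Word 𝔽 n) i → coeff (wpoly c) (toℕ i) ≡ c i
  coeff-wpoly c Fin.zero    = refl
  coeff-wpoly c (Fin.suc i) = coeff-wpoly (c ∘ Fin.suc) i

  degreeBelow-wpoly : ∀ {n} (c : Word 𝔽 n) → DegreeBelow n (wpoly c)
  degreeBelow-wpoly {zero}  c i = refl
  degreeBelow-wpoly {suc n} c i = degreeBelow-wpoly (c ∘ Fin.suc) i

  wpoly-unique : ∀ {n} (c : Word 𝔽 n) p → DegreeBelow n p → (∀ i → c i ≡ coeff p (toℕ i)) → wpoly c ≈ p
  wpoly-unique {zero}  c p degp c≗p = ≈-sym (degreeBelow-0⇒≈[] p degp)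
  wpoly-unique {suc n} c [] degp c≗p = mk≈ λ where
    zero    → c≗p Fin.zero
    (suc i) → coeff≡ (wpoly-unique (c ∘ Fin.suc) [] (λ _ → refl) (c≗p ∘ Fin.suc)) i
  wpoly-unique {suc n} c (a ∷ p) degp c≗p =
    ∷-cong (c≗p Fin.zero) (wpoly-unique (c ∘ Fin.suc) p degp (c≗p ∘ Fin.suc))

  wpoly-cong : ∀ {n} {c d : Word 𝔽 n} → (∀ i → c i ≡ d i) → wpoly c ≈ wpoly d
  wpoly-cong {c = c} {d} c≗d =
    wpoly-unique c (wpoly d) (degreeBelow-wpoly d) λ i → trans (c≗d i) (sym (coeff-wpoly d i))

  inCode-cong : ∀ {n} h {c d : Word 𝔽 n} → (∀ i → c i ≡ d i) → InCode 𝔽 n h c → InCode 𝔽 n h d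
  inCode-cong h c≗d (g , gh≈xⁿ-1 , a , b , c≈ag+bxⁿ-1) =
    g , gh≈xⁿ-1 , a , b , λ i → trans (sym (coeff≡ (wpoly-cong c≗d) i)) (c≈ag+bxⁿ-1 i)

  cyclicPred : ∀ {n} → Fin (suc n) → Fin (suc n)
  cyclicPred Fin.zero    = Fin.fromℕ _
  cyclicPred (Fin.suc i) = Fin.inject₁ i

  module CheckPolynomial {m} (h : Poly 𝔽) (monic-h : Monic m h) where

    record Generator (n : ℕ) : Set where
      field
        g        : Poly 𝔽
        g*h≈xⁿ-1 : g *ₚ h ≈ xⁿ-1 n
        deg      : ℕ
        m+deg≡n  : m ℕ.+ deg ≡ n
        monic-g  : Monic deg g

    generator : ∀ n → h ∣ xⁿ-1 (suc n) → Generator (suc n)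
    generator n (g , gh≈xⁿ-1) with monic-quotient h g monic-h gh≈xⁿ-1
    ... | d , m+d≡n , monic-g = record
      { g = g ; g*h≈xⁿ-1 = gh≈xⁿ-1 ; deg = d ; m+deg≡n = m+d≡n ; monic-g = monic-g }

    module Encoding {n} (G : Generator (suc n)) where
      open Generator G

      encode : Poly 𝔽 → Word 𝔽 (suc n)
      encode r i = coeff (r *ₚ g) (toℕ i)

      IsEncoding : Word 𝔽 (suc n) → Set
      IsEncoding c = ∃[ r ] (DegreeBelow m r × ∀ i → c i ≡ encode r i)

      degreeBelow-*ₚg : ∀ r → DegreeBelow m r → DegreeBelow (suc n) (r *ₚ g)
      degreeBelow-*ₚg r degr = subst (λ N → DegreeBelow N (r *ₚ g)) m+deg≡n (degreeBelow-*ₚ r g degr (proj₂ monic-g))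

      isEncoding⇒inCode : ∀ c → IsEncoding c → InCode 𝔽 (suc n) h c
      isEncoding⇒inCode c (r , degr , c≗rg) = g , coeff≡ g*h≈xⁿ-1 , r , [] , coeff≡ (begin
        wpoly c                 ≈⟨ wpoly-unique c (r *ₚ g) (degreeBelow-*ₚg r degr) c≗rg ⟩
        r *ₚ g                  ≈⟨ +ₚ-identityʳ _ ⟨
        r *ₚ g +ₚ []            ∎)
        where open ≈-Reasoning

      inCode⇒isEncoding : ∀ c → InCode 𝔽 (suc n) h c → IsEncoding c
      inCode⇒isEncoding c (g′ , g′h≈xⁿ-1 , a , b , c≈ag′+bxⁿ-1) with divMod h monic-h a
      ... | t , r , degr , a≈th+r = r , degr , λ i → trans (sym (coeff-wpoly c i)) (coeff≡ c≈rg (toℕ i))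
        where
        N = suc n
        g′≈g : g′ ≈ g
        g′≈g = *ₚ-cancelʳ-monic h monic-h (≈-trans (mk≈ g′h≈xⁿ-1) (≈-sym g*h≈xⁿ-1))
        thg≈txⁿ-1 : t *ₚ h *ₚ g ≈ t *ₚ xⁿ-1 N
        thg≈txⁿ-1 = ≈-trans (*ₚ-assoc t h g) (*ₚ-congˡ t (≈-trans (*ₚ-comm h g) g*h≈xⁿ-1))
        c≈rg+[t+b]xⁿ-1 : wpoly c ≈ r *ₚ g +ₚ (t +ₚ b) *ₚ xⁿ-1 N
        c≈rg+[t+b]xⁿ-1 = begin
          wpoly c                                   ≈⟨ mk≈ c≈ag′+bxⁿ-1 ⟩
          a *ₚ g′ +ₚ b *ₚ xⁿ-1 N                    ≈⟨ +ₚ-cong (*ₚ-cong a≈th+r g′≈g) ≈-refl ⟩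
          (t *ₚ h +ₚ r) *ₚ g +ₚ b *ₚ xⁿ-1 N         ≈⟨ +ₚ-cong (*ₚ-distribʳ-+ₚ g (t *ₚ h) r) ≈-refl ⟩
          (t *ₚ h *ₚ g +ₚ r *ₚ g) +ₚ b *ₚ xⁿ-1 N    ≈⟨ +ₚ-cong (+ₚ-cong thg≈txⁿ-1 ≈-refl) ≈-refl ⟩
          (t *ₚ xⁿ-1 N +ₚ r *ₚ g) +ₚ b *ₚ xⁿ-1 N    ≈⟨ +ₚ-cong (+ₚ-comm (t *ₚ xⁿ-1 N) (r *ₚ g)) ≈-refl ⟩
          (r *ₚ g +ₚ t *ₚ xⁿ-1 N) +ₚ b *ₚ xⁿ-1 N    ≈⟨ +ₚ-assoc (r *ₚ g) _ _ ⟩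
          r *ₚ g +ₚ (t *ₚ xⁿ-1 N +ₚ b *ₚ xⁿ-1 N)    ≈⟨ +ₚ-cong ≈-refl (*ₚ-distribʳ-+ₚ (xⁿ-1 N) t b) ⟨
          r *ₚ g +ₚ (t +ₚ b) *ₚ xⁿ-1 N              ∎
          where open ≈-Reasoning
        high-part-small : DegreeBelow N ((t +ₚ b) *ₚ xⁿ-1 N)
        high-part-small i = begin
          coeff ((t +ₚ b) *ₚ xⁿ-1 N) (N ℕ.+ i)                            ≡⟨ +-identityˡ _ ⟨
          0# + coeff ((t +ₚ b) *ₚ xⁿ-1 N) (N ℕ.+ i)
            ≡⟨ cong (_+ coeff ((t +ₚ b) *ₚ xⁿ-1 N) (N ℕ.+ i)) (degreeBelow-*ₚg r degr i) ⟨
          coeff (r *ₚ g) (N ℕ.+ i) + coeff ((t +ₚ b) *ₚ xⁿ-1 N) (N ℕ.+ i) ≡⟨ coeff-+ (r *ₚ g) _ _ ⟨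
          coeff (r *ₚ g +ₚ (t +ₚ b) *ₚ xⁿ-1 N) (N ℕ.+ i)                  ≡⟨ coeff≡ c≈rg+[t+b]xⁿ-1 (N ℕ.+ i) ⟨
          coeff (wpoly c) (N ℕ.+ i)                                       ≡⟨ degreeBelow-wpoly c i ⟩
          0#                                                              ∎
          where open ≡-Reasoning
        t+b≈0 : t +ₚ b ≈ []
        t+b≈0 = degreeBelow-0⇒≈[] (t +ₚ b) (degreeBelow-*ₚ-monic⁻¹ (xⁿ-1 N) (monic-xⁿ-1 n) 0 (t +ₚ b) high-part-small)
        c≈rg : wpoly c ≈ r *ₚ g
        c≈rg = begin
          wpoly c                          ≈⟨ c≈rg+[t+b]xⁿ-1 ⟩
          r *ₚ g +ₚ (t +ₚ b) *ₚ xⁿ-1 N     ≈⟨ +ₚ-cong ≈-refl (*ₚ-congʳ (xⁿ-1 N) t+b≈0) ⟩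
          r *ₚ g +ₚ []                     ≈⟨ +ₚ-identityʳ _ ⟩
          r *ₚ g                           ∎
          where open ≈-Reasoning

      basis : Fin m → Word 𝔽 (suc n)
      basis j i = coeff (shift (toℕ j) g) (toℕ i)

      ΣF-*-shift : ∀ {k} (λs : Fin k → Carrier) t →
                   ΣF 𝔽 (λ j → λs j * coeff (shift (toℕ j) g) t) ≡ coeff (wpoly λs *ₚ g) t
      ΣF-*-shift {zero}  λs t = refl
      ΣF-*-shift {suc k} λs t =
        trans (cong (λs Fin.zero * coeff g t +_) (tail t)) (sym (coeff-*ₚ-∷ (λs Fin.zero) (wpoly (λs ∘ Fin.suc)) g t))
        where
        ΣF-zero : ∀ {k} {f : Fin k → Carrier} → (∀ j → f j ≡ 0#) → ΣF 𝔽 f ≡ 0#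
        ΣF-zero {zero}  f≗0 = refl
        ΣF-zero {suc k} f≗0 = trans (cong₂ _+_ (f≗0 Fin.zero) (ΣF-zero (f≗0 ∘ Fin.suc))) (+-identityˡ 0#)
        tail : ∀ t → ΣF 𝔽 (λ j → λs (Fin.suc j) * coeff (shift (suc (toℕ j)) g) t)
                   ≡ coeff (0# ∷ wpoly (λs ∘ Fin.suc) *ₚ g) t
        tail zero    = ΣF-zero (λ j → zeroʳ (λs (Fin.suc j)))
        tail (suc t) = ΣF-*-shift (λs ∘ Fin.suc) t

      hasDim : HasDim 𝔽 (InCode 𝔽 (suc n) h) m
      hasDim = basis , basis-inCode , independent , spanning
        where
        basis-inCode : ∀ j → InCode 𝔽 (suc n) h (basis j)
        basis-inCode j = isEncoding⇒inCode (basis j) (shift (toℕ j) 1ₚ , deg-xʲ , λ i →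
          sym (coeff≡ (≈-trans (shift-*ₚ (toℕ j) 1ₚ g) (shift-cong (toℕ j) (*ₚ-identityˡ g))) (toℕ i)))
          where
          deg-xʲ : DegreeBelow m (shift (toℕ j) 1ₚ)
          deg-xʲ = degreeBelow-mono (shift (toℕ j) 1ₚ) (subst (_≤ m) (ℕₚ.+-comm 1 (toℕ j)) (Finₚ.toℕ<n j))
                     (degreeBelow-shift (toℕ j) 1ₚ λ _ → refl)
        independent : ∀ λs → (∀ i → lincomb 𝔽 λs basis i ≡ 0#) → ∀ j → λs j ≡ 0#
        independent λs combination≡0 j = trans (sym (coeff-wpoly λs j)) (coeff≡ λs≈0 (toℕ j))
          where
          λsg≈0 : wpoly λs *ₚ g ≈ []
          λsg≈0 = ≈-trans
            (≈-sym (wpoly-unique (λ _ → 0#) (wpoly λs *ₚ g) (degreeBelow-*ₚg (wpoly λs) (degreeBelow-wpoly λs))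
                                 λ i → trans (sym (combination≡0 i)) (ΣF-*-shift λs (toℕ i))))
            (wpoly-unique (λ _ → 0#) [] (λ _ → refl) (λ _ → refl))
          λs≈0 : wpoly λs ≈ []
          λs≈0 = *ₚ-cancelʳ-monic g monic-g λsg≈0
        spanning : ∀ c → InCode 𝔽 (suc n) h c → ∃[ λs ] (∀ i → c i ≡ lincomb 𝔽 λs basis i)
        spanning c c∈C with inCode⇒isEncoding c c∈C
        ... | r , degr , c≗rg = λs , λ i →
          trans (c≗rg i) (trans (coeff≡ (*ₚ-congʳ g (≈-sym λs≈r)) (toℕ i)) (sym (ΣF-*-shift λs (toℕ i))))
          where
          λs : Fin m → Carrier
          λs j = coeff r (toℕ j)
          λs≈r : wpoly λs ≈ r
          λs≈r = wpoly-unique λs r degr (λ _ → refl)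

    module Repetition {n′₀ k₀} (G′ : Generator (suc n′₀)) (G : Generator (suc k₀ ℕ.* suc n′₀)) where
      n′ = suc n′₀
      k  = suc k₀
      n  = k ℕ.* n′
      open Generator G′ using () renaming (g to g′; g*h≈xⁿ-1 to g′*h≈xⁿ′-1; monic-g to monic-g′)
      open Generator G using (g; g*h≈xⁿ-1)
      module C  = Encoding G
      module C′ = Encoding G′

      repunit : ℕ → Poly 𝔽
      repunit zero    = []
      repunit (suc a) = 1ₚ +ₚ shift n′ (repunit a)

      *ₚ-repunit-suc : ∀ u a → u *ₚ repunit (suc a) ≈ u +ₚ shift n′ (u *ₚ repunit a)
      *ₚ-repunit-suc u a =
        ≈-trans (*ₚ-distribˡ-+ₚ u 1ₚ _) (+ₚ-cong (*ₚ-identityʳ u) (*ₚ-shift n′ u (repunit a)))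

      xⁿ′-1*repunit : ∀ a → xⁿ-1 n′ *ₚ repunit a ≈ xⁿ-1 (a ℕ.* n′)
      xⁿ′-1*repunit zero    = ≈-trans (*ₚ-zeroʳ (xⁿ-1 n′)) (≈-sym xⁿ-1-zero)
      xⁿ′-1*repunit (suc a) = begin
        xⁿ-1 n′ *ₚ repunit (suc a)                      ≈⟨ *ₚ-repunit-suc (xⁿ-1 n′) a ⟩
        xⁿ-1 n′ +ₚ shift n′ (xⁿ-1 n′ *ₚ repunit a)      ≈⟨ +ₚ-cong {xⁿ-1 n′} ≈-refl (shift-cong n′ (xⁿ′-1*repunit a)) ⟩
        xⁿ-1 n′ +ₚ shift n′ (xⁿ-1 (a ℕ.* n′))           ≈⟨ +ₚ-comm (xⁿ-1 n′) (shift n′ (xⁿ-1 (a ℕ.* n′))) ⟩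
        shift n′ (xⁿ-1 (a ℕ.* n′)) +ₚ xⁿ-1 n′           ≈⟨ xⁿ-1-+ n′ (a ℕ.* n′) ⟨
        xⁿ-1 (suc a ℕ.* n′)                             ∎
        where open ≈-Reasoning

      g≈g′*repunit : g ≈ g′ *ₚ repunit k
      g≈g′*repunit = *ₚ-cancelʳ-monic h monic-h (begin
        g *ₚ h                          ≈⟨ g*h≈xⁿ-1 ⟩
        xⁿ-1 n                          ≈⟨ xⁿ′-1*repunit k ⟨
        xⁿ-1 n′ *ₚ repunit k            ≈⟨ *ₚ-congʳ (repunit k) g′*h≈xⁿ′-1 ⟨
        (g′ *ₚ h) *ₚ repunit k          ≈⟨ *ₚ-assoc g′ h (repunit k) ⟩
        g′ *ₚ (h *ₚ repunit k)          ≈⟨ *ₚ-congˡ g′ (*ₚ-comm h (repunit k)) ⟩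
        g′ *ₚ (repunit k *ₚ h)          ≈⟨ *ₚ-assoc g′ (repunit k) h ⟨
        (g′ *ₚ repunit k) *ₚ h          ∎)
        where open ≈-Reasoning

      coeff-*ₚ-repunit : ∀ u → DegreeBelow n′ u → ∀ a b j → j < n′ → b < a →
                         coeff (u *ₚ repunit a) (b ℕ.* n′ ℕ.+ j) ≡ coeff u j
      coeff-*ₚ-repunit u degu (suc a) zero j j<n′ _ = begin
        coeff (u *ₚ repunit (suc a)) j                    ≡⟨ coeff≡ (*ₚ-repunit-suc u a) j ⟩
        coeff (u +ₚ shift n′ (u *ₚ repunit a)) j          ≡⟨ coeff-+ u _ j ⟩
        coeff u j + coeff (shift n′ (u *ₚ repunit a)) j   ≡⟨ cong (coeff u j +_) (coeff-shift-< n′ _ j j<n′) ⟩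
        coeff u j + 0#                                    ≡⟨ +-identityʳ _ ⟩
        coeff u j                                         ∎
        where open ≡-Reasoning
      coeff-*ₚ-repunit u degu (suc a) (suc b) j j<n′ (s≤s b<a) = begin
        coeff (u *ₚ repunit (suc a)) (n′ ℕ.+ b ℕ.* n′ ℕ.+ j)               ≡⟨ coeff≡ (*ₚ-repunit-suc u a) _ ⟩
        coeff (u +ₚ shift n′ (u *ₚ repunit a)) (n′ ℕ.+ b ℕ.* n′ ℕ.+ j)     ≡⟨ coeff-+ u _ _ ⟩
        coeff u (n′ ℕ.+ b ℕ.* n′ ℕ.+ j) + coeff (shift n′ (u *ₚ repunit a)) (n′ ℕ.+ b ℕ.* n′ ℕ.+ j)
          ≡⟨ cong₂ _+_ (trans (cong (coeff u) (ℕₚ.+-assoc n′ _ j)) (degu _))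
                       (trans (cong (coeff (shift n′ _)) (ℕₚ.+-assoc n′ _ j)) (coeff-shift-+ n′ _ _)) ⟩
        0# + coeff (u *ₚ repunit a) (b ℕ.* n′ ℕ.+ j)                       ≡⟨ +-identityˡ _ ⟩
        coeff (u *ₚ repunit a) (b ℕ.* n′ ℕ.+ j)                            ≡⟨ coeff-*ₚ-repunit u degu a b j j<n′ b<a ⟩
        coeff u j                                                          ∎
        where open ≡-Reasoning

      coeff-*ₚ-repunit-% : ∀ u → DegreeBelow n′ u → ∀ (i : Fin n) →
                           coeff (u *ₚ repunit k) (toℕ i) ≡ coeff u (toℕ i ℕ.% n′)
      coeff-*ₚ-repunit-% u degu i = trans
        (cong (coeff (u *ₚ repunit k)) (trans (ℕ.m≡m%n+[m/n]*n (toℕ i) n′) (ℕₚ.+-comm (toℕ i ℕ.% n′) _)))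
        (coeff-*ₚ-repunit u degu k (toℕ i ℕ./ n′) (toℕ i ℕ.% n′) (ℕ.m%n<n (toℕ i) n′) (ℕ.m<n*o⇒m/o<n (Finₚ.toℕ<n i)))

      encode-repeats : (n′≥1 : 1 ≤ n′) → ∀ r → DegreeBelow m r → ∀ i → C.encode r i ≡ C′.encode r (reduce n′≥1 (toℕ i))
      encode-repeats n′≥1 r degr i = begin
        coeff (r *ₚ g) (toℕ i)                  ≡⟨ coeff≡ (*ₚ-congˡ r g≈g′*repunit) (toℕ i) ⟩
        coeff (r *ₚ (g′ *ₚ repunit k)) (toℕ i)  ≡⟨ coeff≡ (*ₚ-assoc r g′ (repunit k)) (toℕ i) ⟨
        coeff (r *ₚ g′ *ₚ repunit k) (toℕ i)    ≡⟨ coeff-*ₚ-repunit-% (r *ₚ g′) (C′.degreeBelow-*ₚg r degr) i ⟩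
        coeff (r *ₚ g′) (toℕ i ℕ.% n′)          ≡⟨ cong (coeff (r *ₚ g′)) (toℕ-reduce n′≥1 (toℕ i)) ⟨
        coeff (r *ₚ g′) (toℕ (reduce n′≥1 (toℕ i))) ∎
        where open ≡-Reasoning

      inCode⇔repeated : (n′≥1 : 1 ≤ n′) → ∀ c →
        InCode 𝔽 n h c ⇔ (∃[ c′ ] (InCode 𝔽 n′ h c′ × ∀ i → c i ≡ c′ (reduce n′≥1 (toℕ i))))
      inCode⇔repeated n′≥1 c = mk⇔ to from
        where
        to : InCode 𝔽 n h c → ∃[ c′ ] (InCode 𝔽 n′ h c′ × ∀ i → c i ≡ c′ (reduce n′≥1 (toℕ i)))
        to c∈C with C.inCode⇒isEncoding c c∈C
        ... | r , degr , c≗rg = C′.encode r , C′.isEncoding⇒inCode _ (r , degr , λ _ → refl) ,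
                                λ i → trans (c≗rg i) (encode-repeats n′≥1 r degr i)
        from : ∃[ c′ ] (InCode 𝔽 n′ h c′ × ∀ i → c i ≡ c′ (reduce n′≥1 (toℕ i))) → InCode 𝔽 n h c
        from (c′ , c′∈C′ , c≗c′) with C′.inCode⇒isEncoding c′ c′∈C′
        ... | r , degr , c′≗rg′ = C.isEncoding⇒inCode c (r , degr , λ i →
          trans (c≗c′ i) (trans (c′≗rg′ _) (sym (encode-repeats n′≥1 r degr i))))

    module Rotation {n′₀} (G′ : Generator (suc n′₀)) where
      n′ = suc n′₀
      open Generator G′ using ()
        renaming (g to g′; g*h≈xⁿ-1 to g′*h≈xⁿ′-1; monic-g to monic-g′; m+deg≡n to m+deg≡n′)
      module C′ = Encoding G′

      -- Multiplication by x modulo xⁿ′ − 1 on messages: x·(r g′) = rotate r · g′ + c·(xⁿ′ − 1),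
      -- where c is the top coefficient of r.
      rotate : Poly 𝔽 → Poly 𝔽
      rotate r = (0# ∷ r) -ₚ coeff (0# ∷ r) m ·ₚ h

      degreeBelow-rotate : ∀ r → DegreeBelow m r → DegreeBelow m (rotate r)
      degreeBelow-rotate r degr = degreeBelow-eliminateTop h monic-h (0# ∷ r) degr

      coeff-rotate*g′ : ∀ r i → coeff (rotate r *ₚ g′) i ≡ coeff (0# ∷ r *ₚ g′) i + - (coeff (0# ∷ r) m * coeff (xⁿ-1 n′) i)
      coeff-rotate*g′ r i = begin
        coeff (rotate r *ₚ g′) i                      ≡⟨ coeff≡ (*ₚ-distribʳ--ₚ (0# ∷ r) (c ·ₚ h) g′) i ⟩
        coeff ((0# ∷ r) *ₚ g′ -ₚ (c ·ₚ h) *ₚ g′) i    ≡⟨ coeff-- ((0# ∷ r) *ₚ g′) _ i ⟩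
        coeff ((0# ∷ r) *ₚ g′) i + - coeff ((c ·ₚ h) *ₚ g′) i
          ≡⟨ cong₂ (λ u v → u + - v) (coeff≡ (shift-*ₚ 1 r g′) i) (coeff≡ chg′≈cxⁿ′-1 i) ⟩
        coeff (0# ∷ r *ₚ g′) i + - coeff (c ·ₚ xⁿ-1 n′) i ≡⟨ cong (λ u → coeff (0# ∷ r *ₚ g′) i + - u) (coeff-· c (xⁿ-1 n′) i) ⟩
        coeff (0# ∷ r *ₚ g′) i + - (c * coeff (xⁿ-1 n′) i) ∎
        where
        open ≡-Reasoning
        c = coeff (0# ∷ r) m
        chg′≈cxⁿ′-1 : (c ·ₚ h) *ₚ g′ ≈ c ·ₚ xⁿ-1 n′
        chg′≈cxⁿ′-1 = ≈-trans (·ₚ-*ₚ-assoc c h g′) (·ₚ-cong c (≈-trans (*ₚ-comm h g′) g′*h≈xⁿ′-1))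

      coeff-rotate-zero : ∀ r → DegreeBelow m r → coeff (rotate r *ₚ g′) 0 ≡ coeff (r *ₚ g′) n′₀
      coeff-rotate-zero r degr = begin
        coeff (rotate r *ₚ g′) 0                      ≡⟨ coeff-rotate*g′ r 0 ⟩
        0# + - (c * coeff (xⁿ-1 n′) 0)                ≡⟨ +-identityˡ _ ⟩
        - (c * ((- 1#) + 0#))                         ≡⟨ cong (λ u → - (c * u)) (+-identityʳ (- 1#)) ⟩
        - (c * - 1#)                                  ≡⟨ cong -_ (-‿distribʳ-* c 1#) ⟨
        - - (c * 1#)                                  ≡⟨ -‿involutive _ ⟩
        c * 1#                                        ≡⟨ *-identityʳ c ⟩
        c                                             ≡⟨ coeff-*ₚ-top r g′ degr monic-g′ m+deg≡n′ ⟨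
        coeff (r *ₚ g′) n′₀                           ∎
        where
        open ≡-Reasoning
        c = coeff (0# ∷ r) m

      coeff-rotate-suc : ∀ r i → suc i < n′ → coeff (rotate r *ₚ g′) (suc i) ≡ coeff (r *ₚ g′) i
      coeff-rotate-suc r i 1+i<n′ = begin
        coeff (rotate r *ₚ g′) (suc i)                ≡⟨ coeff-rotate*g′ r (suc i) ⟩
        coeff (r *ₚ g′) i + - (c * coeff (xⁿ-1 n′) (suc i))
          ≡⟨ cong (λ u → coeff (r *ₚ g′) i + - (c * u))
                  (trans (coeff-xⁿ-1-suc n′ i) (coeff-shift-< n′ 1ₚ (suc i) 1+i<n′)) ⟩
        coeff (r *ₚ g′) i + - (c * 0#)                ≡⟨ cong (λ u → coeff (r *ₚ g′) i + - u) (zeroʳ c) ⟩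
        coeff (r *ₚ g′) i + - 0#                      ≡⟨ cong (coeff (r *ₚ g′) i +_) -0#≈0# ⟩
        coeff (r *ₚ g′) i + 0#                        ≡⟨ +-identityʳ _ ⟩
        coeff (r *ₚ g′) i                             ∎
        where
        open ≡-Reasoning
        c = coeff (0# ∷ r) m

      inCode-cyclic : ∀ c → InCode 𝔽 n′ h c → InCode 𝔽 n′ h (c ∘ cyclicPred)
      inCode-cyclic c c∈C′ with C′.inCode⇒isEncoding c c∈C′
      ... | r , degr , c≗rg′ = C′.isEncoding⇒inCode (c ∘ cyclicPred) (rotate r , degreeBelow-rotate r degr , shifted)
        where
        shifted : ∀ i → c (cyclicPred i) ≡ C′.encode (rotate r) i
        shifted Fin.zero    = trans (c≗rg′ (Fin.fromℕ n′₀))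
          (trans (cong (coeff (r *ₚ g′)) (Finₚ.toℕ-fromℕ n′₀)) (sym (coeff-rotate-zero r degr)))
        shifted (Fin.suc i) = trans (c≗rg′ (Fin.inject₁ i))
          (trans (cong (coeff (r *ₚ g′)) (Finₚ.toℕ-inject₁ i)) (sym (coeff-rotate-suc r (toℕ i) (s≤s (Finₚ.toℕ<n i)))))

    module Separation {n′₀} (G′ : Generator (suc n′₀))
                      (minimal : ∀ k → 1 ≤ k → h ∣ xⁿ-1 k → suc n′₀ ≤ k) where
      open Rotation G′ using (n′; rotate; degreeBelow-rotate; coeff-rotate-zero; coeff-rotate-suc)
      open Generator G′ using ()
        renaming (g to g′; g*h≈xⁿ-1 to g′*h≈xⁿ′-1; monic-g to monic-g′; m+deg≡n to m+deg≡n′)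
      module C′ = Encoding G′

      Agree : ℕ → ℕ → Set
      Agree a b = ∀ r → DegreeBelow m r → coeff (r *ₚ g′) a ≡ coeff (r *ₚ g′) b

      agree-sym : ∀ {a b} → Agree a b → Agree b a
      agree-sym agree r degr = sym (agree r degr)

      agree-pred : ∀ {a b} → suc a < n′ → suc b < n′ → Agree (suc a) (suc b) → Agree a b
      agree-pred {a} {b} 1+a<n′ 1+b<n′ agree r degr = begin
        coeff (r *ₚ g′) a               ≡⟨ coeff-rotate-suc r a 1+a<n′ ⟨
        coeff (rotate r *ₚ g′) (suc a)  ≡⟨ agree (rotate r) (degreeBelow-rotate r degr) ⟩
        coeff (rotate r *ₚ g′) (suc b)  ≡⟨ coeff-rotate-suc r b 1+b<n′ ⟩
        coeff (r *ₚ g′) b               ∎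
        where open ≡-Reasoning

      agree-wrap : ∀ {b} → suc b < n′ → Agree 0 (suc b) → Agree n′₀ b
      agree-wrap {b} 1+b<n′ agree r degr = begin
        coeff (r *ₚ g′) n′₀             ≡⟨ coeff-rotate-zero r degr ⟨
        coeff (rotate r *ₚ g′) 0        ≡⟨ agree (rotate r) (degreeBelow-rotate r degr) ⟩
        coeff (rotate r *ₚ g′) (suc b)  ≡⟨ coeff-rotate-suc r b 1+b<n′ ⟩
        coeff (r *ₚ g′) b               ∎
        where open ≡-Reasoning

      agree-pred* : ∀ t {a b} → t ℕ.+ a < n′ → t ℕ.+ b < n′ → Agree (t ℕ.+ a) (t ℕ.+ b) → Agree a b
      agree-pred* zero    _ _ agree = agree
      agree-pred* (suc t) 1+t+a<n′ 1+t+b<n′ agree =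
        agree-pred* t (ℕₚ.<-trans (ℕₚ.n<1+n _) 1+t+a<n′) (ℕₚ.<-trans (ℕₚ.n<1+n _) 1+t+b<n′)
                    (agree-pred 1+t+a<n′ 1+t+b<n′ agree)

      agree-descend : ∀ y x → y ℕ.+ x < n′ → Agree (y ℕ.+ x) x → ∀ t → t ≤ x → Agree (y ℕ.+ t) t
      agree-descend y x y+x<n′ agree t t≤x with ℕₚ.m≤n⇒∃[o]m+o≡n t≤x
      ... | u , refl = agree-pred* u (subst (_< n′) reassoc y+x<n′)
                                     (ℕₚ.≤-<-trans (ℕₚ.≤-reflexive (ℕₚ.+-comm u t)) (ℕₚ.≤-<-trans (ℕₚ.m≤n+m _ y) y+x<n′))
                                     (subst₂ Agree reassoc (ℕₚ.+-comm t u) agree)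
        where
        reassoc : y ℕ.+ (t ℕ.+ u) ≡ u ℕ.+ (y ℕ.+ t)
        reassoc = solve 3 (λ y t u → y :+ (t :+ u) := u :+ (y :+ t)) refl y t u

      agree⇒coeff-g′≡ : 1 ≤ m → ∀ {a b} → Agree a b → coeff g′ a ≡ coeff g′ b
      agree⇒coeff-g′≡ 1≤m {a} {b} agree = begin
        coeff g′ a           ≡⟨ coeff≡ (*ₚ-identityˡ g′) a ⟨
        coeff (1ₚ *ₚ g′) a   ≡⟨ agree 1ₚ (degreeBelow-mono 1ₚ 1≤m λ _ → refl) ⟩
        coeff (1ₚ *ₚ g′) b   ≡⟨ coeff≡ (*ₚ-identityˡ g′) b ⟩
        coeff g′ b           ∎
        where open ≡-Reasoning

      -- Rotating the agreement of positions 0 and d around the cycle makes g′ cyclically d-periodic.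
      agree⇒∣xᵈ-1 : 1 ≤ m → ∀ d₀ e₀ → suc d₀ ℕ.+ suc e₀ ≡ n′ → Agree 0 (suc d₀) → h ∣ xⁿ-1 (suc d₀)
      agree⇒∣xᵈ-1 1≤m d₀ e₀ d+e≡n′ agree-0-d = drop e g′ , *ₚ-cancelˡ-monic g′ monic-g′ (begin
        g′ *ₚ (drop e g′ *ₚ h)   ≈⟨ *ₚ-congˡ g′ (*ₚ-comm (drop e g′) h) ⟩
        g′ *ₚ (h *ₚ drop e g′)   ≈⟨ *ₚ-assoc g′ h (drop e g′) ⟨
        (g′ *ₚ h) *ₚ drop e g′   ≈⟨ *ₚ-congʳ (drop e g′) g′*h≈xⁿ′-1 ⟩
        xⁿ-1 n′ *ₚ drop e g′     ≈⟨ xᵈ-1*g′≈xⁿ′-1*drop ⟨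
        xⁿ-1 d *ₚ g′             ≈⟨ *ₚ-comm (xⁿ-1 d) g′ ⟩
        g′ *ₚ xⁿ-1 d             ∎)
        where
        open ≈-Reasoning
        d = suc d₀
        e = suc e₀
        n′₀≡e+d₀ : n′₀ ≡ e ℕ.+ d₀
        n′₀≡e+d₀ = trans (sym (ℕₚ.suc-injective d+e≡n′)) (ℕₚ.+-comm d₀ e)
        n′₀≡d+e₀ : n′₀ ≡ d ℕ.+ e₀
        n′₀≡d+e₀ = trans (sym (ℕₚ.suc-injective d+e≡n′)) (ℕₚ.+-suc d₀ e₀)
        wrap-e : ∀ t → t < d → Agree (e ℕ.+ t) t
        wrap-e t (s≤s t≤d₀) =
          agree-descend e d₀ (subst (_< n′) n′₀≡e+d₀ (ℕₚ.n<1+n n′₀))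
            (subst (λ x → Agree x d₀) n′₀≡e+d₀ (agree-wrap (subst (d <_) d+e≡n′ (ℕₚ.m<m+n d (s≤s z≤n))) agree-0-d))
            t t≤d₀
        agree-0-e : Agree 0 e
        agree-0-e = agree-sym (subst (λ x → Agree x 0) (ℕₚ.+-identityʳ e) (wrap-e 0 (s≤s z≤n)))
        shift-d : ∀ i → i < e → Agree (d ℕ.+ i) i
        shift-d i (s≤s i≤e₀) =
          agree-descend d e₀ (subst (_< n′) n′₀≡d+e₀ (ℕₚ.n<1+n n′₀))
            (subst (λ x → Agree x e₀) n′₀≡d+e₀ (agree-wrap (subst (e <_) d+e≡n′ (ℕₚ.m<n+m e (s≤s z≤n))) agree-0-e))
            i i≤e₀
        deg-g′ : DegreeBelow (d ℕ.+ e) g′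
        deg-g′ = subst (λ N → DegreeBelow N g′) (trans m+deg≡n′ (sym d+e≡n′))
                   (degreeBelow-mono g′ (ℕₚ.+-monoˡ-≤ _ 1≤m) (proj₂ monic-g′))
        xᵈ-1*g′≈xⁿ′-1*drop : xⁿ-1 d *ₚ g′ ≈ xⁿ-1 n′ *ₚ drop e g′
        xᵈ-1*g′≈xⁿ′-1*drop = subst (λ N → xⁿ-1 d *ₚ g′ ≈ xⁿ-1 N *ₚ drop e g′) d+e≡n′
          (CyclicallyPeriodic.xᵈ-1*p≈xᵈ⁺ᵉ-1*drop d e g′ deg-g′
            (λ t t<d → agree⇒coeff-g′≡ 1≤m (wrap-e t t<d)) (λ i i<e → agree⇒coeff-g′≡ 1≤m (shift-d i i<e)))

      no-agreement : 1 ≤ m → ∀ j d₀ → j ℕ.+ suc d₀ < n′ → Agree j (j ℕ.+ suc d₀) → ⊥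
      no-agreement 1≤m j d₀ j+d<n′ agree with ℕₚ.m≤n⇒∃[o]m+o≡n (ℕₚ.≤-trans (ℕₚ.+-monoʳ-≤ 1 (ℕₚ.m≤n+m (suc d₀) j)) j+d<n′)
      ... | e₀ , d+1+e₀≡n′ = ℕₚ.<⇒≱ d<n′ (minimal (suc d₀) (s≤s z≤n) (agree⇒∣xᵈ-1 1≤m d₀ e₀ d+e≡n′ agree-0-d))
        where
        d<n′ : suc d₀ < n′
        d<n′ = ℕₚ.≤-<-trans (ℕₚ.m≤n+m (suc d₀) j) j+d<n′
        d+e≡n′ : suc d₀ ℕ.+ suc e₀ ≡ n′
        d+e≡n′ = trans (ℕₚ.+-suc (suc d₀) e₀) d+1+e₀≡n′
        agree-0-d : Agree 0 (suc d₀)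
        agree-0-d = agree-pred* j (subst (_< n′) (sym (ℕₚ.+-identityʳ j)) (ℕₚ.≤-<-trans (ℕₚ.m≤m+n j _) j+d<n′)) j+d<n′
                                  (subst (λ x → Agree x (j ℕ.+ suc d₀)) (sym (ℕₚ.+-identityʳ j)) agree)

      no-agreement-Fin : 1 ≤ m → ∀ (a b : Fin n′) → toℕ a < toℕ b → Agree (toℕ a) (toℕ b) → ⊥
      no-agreement-Fin 1≤m a b a<b agree with ℕₚ.m≤n⇒∃[o]m+o≡n a<b
      ... | o , 1+a+o≡b = no-agreement 1≤m (toℕ a) o (subst (_< n′) b≡a+1+o (Finₚ.toℕ<n b))
                                                    (subst (Agree (toℕ a)) b≡a+1+o agree)
        where
        b≡a+1+o : toℕ b ≡ toℕ a ℕ.+ suc o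
        b≡a+1+o = trans (sym 1+a+o≡b) (sym (ℕₚ.+-suc (toℕ a) o))

      agreeOnCode⇒Agree : ∀ (j j′ : Fin n′) → (∀ c′ → InCode 𝔽 n′ h c′ → c′ j ≡ c′ j′) → Agree (toℕ j) (toℕ j′)
      agreeOnCode⇒Agree j j′ agree r degr = agree (C′.encode r) (C′.isEncoding⇒inCode _ (r , degr , λ _ → refl))

      m≡0⇒n′≡1 : m ≡ 0 → ∀ (i : Fin n′) → toℕ i ≡ 0
      m≡0⇒n′≡1 m≡0 i = ℕₚ.n<1⇒n≡0 (ℕₚ.<-≤-trans (Finₚ.toℕ<n i) (minimal 1 (s≤s z≤n) h∣x-1))
        where
        h∣x-1 : h ∣ xⁿ-1 1
        h∣x-1 = xⁿ-1 1 , ≈-trans (*ₚ-congˡ (xⁿ-1 1) (monic-0⇒≈1ₚ (subst (λ k → Monic k h) m≡0 monic-h)))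
                                 (*ₚ-identityʳ (xⁿ-1 1))

      separates : ∀ (j j′ : Fin n′) → j ≢ j′ → (∀ c′ → InCode 𝔽 n′ h c′ → c′ j ≡ c′ j′) → ⊥
      separates j j′ j≢j′ agree with m ℕ.≟ 0 | ℕₚ.<-cmp (toℕ j) (toℕ j′)
      ... | yes m≡0 | _ = j≢j′ (Finₚ.toℕ-injective (trans (m≡0⇒n′≡1 m≡0 j) (sym (m≡0⇒n′≡1 m≡0 j′))))
      ... | no _    | tri≈ _ j≡j′ _ = j≢j′ (Finₚ.toℕ-injective j≡j′)
      ... | no m≢0  | tri< j<j′ _ _ =
        no-agreement-Fin (ℕₚ.n≢0⇒n>0 m≢0) j j′ j<j′ (agreeOnCode⇒Agree j j′ agree)
      ... | no m≢0  | tri> _ _ j′<j =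
        no-agreement-Fin (ℕₚ.n≢0⇒n>0 m≢0) j′ j j′<j (agree-sym (agreeOnCode⇒Agree j j′ agree))

InPAut-id : ∀ {q} (𝔽 : FiniteField q) {n} (C : Word 𝔽 n → Set) → InPAut 𝔽 C Perm.id
InPAut-id 𝔽 C c = mk⇔ (λ c∈C → c∈C) (λ c∈C → c∈C)

InPAut-resp : ∀ {q} (𝔽 : FiniteField q) {n} (C : Word 𝔽 n → Set) → (∀ {c d} → (∀ i → c i ≡ d i) → C c → C d) →
              ∀ {τ τ′} → τ Perm.≈ τ′ → InPAut 𝔽 C τ → InPAut 𝔽 C τ′
InPAut-resp 𝔽 C C-resp τ≈τ′ τ∈PAut c = mk⇔
  (λ c∈C → C-resp (λ i → cong c (τ≈τ′ i)) (Equivalence.to (τ∈PAut c) c∈C))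
  (λ cτ′∈C → Equivalence.from (τ∈PAut c) (C-resp (λ i → cong c (sym (τ≈τ′ i))) cτ′∈C))

module WreathProduct {q : ℕ} (𝔽 : FiniteField q) {n n′ : ℕ}
  (red : Fin n → Fin n′) (ι : Fin n′ → Fin n) (red∘ι : ∀ j → red (ι j) ≡ j)
  (C : Word 𝔽 n → Set) (C′ : Word 𝔽 n′ → Set)
  (C-resp : ∀ {c d} → (∀ i → c i ≡ d i) → C c → C d)
  (C′-resp : ∀ {c d} → (∀ i → c i ≡ d i) → C′ c → C′ d)
  (C⇔repeated : ∀ c → C c ⇔ (∃[ c′ ] (C′ c′ × ∀ i → c i ≡ c′ (red i))))
  (C′-separates : ∀ j j′ → j ≢ j′ → (∀ c′ → C′ c′ → c′ j ≡ c′ j′) → ⊥)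
  where

  unrepeat : ∀ {c} → C c → ∃[ c′ ] (C′ c′ × ∀ i → c i ≡ c′ (red i))
  unrepeat {c} = Equivalence.to (C⇔repeated c)

  repeat : ∀ {c′} → C′ c′ → C (c′ ∘ red)
  repeat {c′} c′∈C′ = Equivalence.from (C⇔repeated (c′ ∘ red)) (c′ , c′∈C′ , λ _ → refl)

  permute : ∀ {m} (π : Permutation′ m) → Word 𝔽 m → Word 𝔽 m
  permute π c i = c (π ⟨$⟩ʳ i)

  PAut-flip : ∀ π → InPAut 𝔽 C π → InPAut 𝔽 C (flip π)
  PAut-flip π π∈PAut c = mk⇔
    (λ c∈C → Equivalence.from (π∈PAut (permute (flip π) c)) (C-resp (λ i → sym (cong c (inverseˡ π))) c∈C))
    (λ c∘π⁻¹∈C → C-resp (λ i → cong c (inverseˡ π)) (Equivalence.to (π∈PAut (permute (flip π) c)) c∘π⁻¹∈C))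

  PAut-preserves-fibres : ∀ π → InPAut 𝔽 C π → ∀ i i′ → red i ≡ red i′ → red (π ⟨$⟩ʳ i) ≡ red (π ⟨$⟩ʳ i′)
  PAut-preserves-fibres π π∈PAut i i′ redi≡redi′ with red (π ⟨$⟩ʳ i) Finₚ.≟ red (π ⟨$⟩ʳ i′)
  ... | yes same = same
  ... | no differ = ⊥-elim (C′-separates _ _ differ λ c′ c′∈C′ →
    let c″ , _ , c′∘red∘π≗c″∘red = unrepeat (Equivalence.to (π∈PAut (c′ ∘ red)) (repeat c′∈C′))
    in trans (c′∘red∘π≗c″∘red i) (trans (cong c″ redi≡redi′) (sym (c′∘red∘π≗c″∘red i′))))

  induced : Permutation′ n → Fin n′ → Fin n′
  induced π j = red (π ⟨$⟩ʳ ι j)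

  induced-closed : ∀ π → InPAut 𝔽 C π → ∀ {c′} → C′ c′ → C′ (c′ ∘ induced π)
  induced-closed π π∈PAut {c′} c′∈C′ with unrepeat (Equivalence.to (π∈PAut (c′ ∘ red)) (repeat c′∈C′))
  ... | c″ , c″∈C′ , c′∘red∘π≗c″∘red =
    C′-resp (λ j → sym (trans (c′∘red∘π≗c″∘red (ι j)) (cong c″ (red∘ι j)))) c″∈C′

  induced-resp-red : ∀ π → InPAut 𝔽 C π → ∀ i → induced π (red i) ≡ red (π ⟨$⟩ʳ i)
  induced-resp-red π π∈PAut i = PAut-preserves-fibres π π∈PAut (ι (red i)) i (red∘ι (red i))

  module Induced {π : Permutation′ n} (π∈PAut : InPAut 𝔽 C π) where

    π⁻¹∈PAut : InPAut 𝔽 C (flip π)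
    π⁻¹∈PAut = PAut-flip π π∈PAut

    τ : Permutation′ n′
    τ = permutation (induced π) (induced (flip π))
      (λ j → trans (induced-resp-red π π∈PAut (π ⟨$⟩ˡ ι j)) (trans (cong red (inverseʳ π)) (red∘ι j)))
      (λ j → trans (induced-resp-red (flip π) π⁻¹∈PAut (π ⟨$⟩ʳ ι j)) (trans (cong red (inverseˡ π)) (red∘ι j)))

    τ∈PAut : InPAut 𝔽 C′ τ
    τ∈PAut c′ = mk⇔ (induced-closed π π∈PAut) λ c′∘τ∈C′ →
      C′-resp (λ j → cong c′ (inverseʳ τ)) (induced-closed (flip π) π⁻¹∈PAut c′∘τ∈C′)

  lift-PAut : ∀ π τ → InPAut 𝔽 C′ τ → (∀ i → red (π ⟨$⟩ʳ i) ≡ τ ⟨$⟩ʳ red i) → InPAut 𝔽 C π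
  lift-PAut π τ τ∈PAut red∘π≗τ∘red c = mk⇔ to from
    where
    red∘π⁻¹≗τ⁻¹∘red : ∀ i → red (π ⟨$⟩ˡ i) ≡ τ ⟨$⟩ˡ red i
    red∘π⁻¹≗τ⁻¹∘red i = trans (sym (inverseˡ τ))
      (cong (τ ⟨$⟩ˡ_) (trans (sym (red∘π≗τ∘red (π ⟨$⟩ˡ i))) (cong red (inverseʳ π))))
    to : C c → C (permute π c)
    to c∈C with unrepeat c∈C
    ... | c′ , c′∈C′ , c≗c′∘red = Equivalence.from (C⇔repeated (permute π c))
      (c′ ∘ (τ ⟨$⟩ʳ_) , Equivalence.to (τ∈PAut c′) c′∈C′ ,
       λ i → trans (c≗c′∘red (π ⟨$⟩ʳ i)) (cong c′ (red∘π≗τ∘red i)))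
    from : C (permute π c) → C c
    from cπ∈C with unrepeat cπ∈C
    ... | c″ , c″∈C′ , cπ≗c″∘red = Equivalence.from (C⇔repeated c)
      (c″ ∘ (τ ⟨$⟩ˡ_) ,
       Equivalence.from (τ∈PAut (c″ ∘ (τ ⟨$⟩ˡ_))) (C′-resp (λ j → sym (cong c″ (inverseˡ τ))) c″∈C′) ,
       λ i → trans (cong c (sym (inverseʳ π))) (trans (cπ≗c″∘red (π ⟨$⟩ˡ i)) (cong c″ (red∘π⁻¹≗τ⁻¹∘red i))))

  inPAut⇔inducesPAut : ∀ π → InPAut 𝔽 C π ⇔ (∃[ τ ] (InPAut 𝔽 C′ τ × ∀ i → red (π ⟨$⟩ʳ i) ≡ τ ⟨$⟩ʳ red i))
  inPAut⇔inducesPAut π = mk⇔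
    (λ π∈PAut → let open Induced {π} π∈PAut in τ , τ∈PAut , λ i → sym (induced-resp-red π π∈PAut i))
    (λ (τ , τ∈PAut , red∘π≗τ∘red) → lift-PAut π τ τ∈PAut red∘π≗τ∘red)

module Counting where

  open import Data.Fin.Permutation using (_≈_; insert; remove; insert-remove)
  open import Data.Fin using (combine; quotient; remainder; punchIn)
  open import Data.Unit using (⊤; tt)

  -- Defs.Card P N is Enumeration (Permutation′ n) _≈_ P N.
  Enumeration : (A : Set) → (A → A → Set) → (A → Set) → ℕ → Set
  Enumeration A _~_ P N = Σ (Fin N → A) λ f → (∀ j → P (f j))
    × (∀ j j′ → f j ~ f j′ → j ≡ j′) × (∀ a → P a → ∃[ j ] (f j ~ a))

  enumeration-map : ∀ {A B : Set} {_~_ : A → A → Set} {_≋_ : B → B → Set} {P : A → Set} {Q : B → Set} {N} →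
    (∀ {x y z} → x ≋ y → y ≋ z → x ≋ z) →
    (φ : A → B) → (∀ {a a′} → a ~ a′ → φ a ≋ φ a′) → (∀ a → P a → Q (φ a)) →
    (∀ a a′ → P a → P a′ → φ a ≋ φ a′ → a ~ a′) → (∀ b → Q b → ∃[ a ] (P a × φ a ≋ b)) →
    Enumeration A _~_ P N → Enumeration B _≋_ Q N
  enumeration-map ≋-trans φ φ-cong φ-P φ-injective φ-surjective (f , f-P , f-injective , f-surjective) =
    φ ∘ f , (λ j → φ-P (f j) (f-P j)) ,
    (λ j j′ φfj≋φfj′ → f-injective j j′ (φ-injective (f j) (f j′) (f-P j) (f-P j′) φfj≋φfj′)) ,
    λ b Qb → let a , Pa , φa≋b = φ-surjective b Qb ; j , fj~a = f-surjective a Pa in j , ≋-trans (φ-cong fj~a) φa≋b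

  _×-rel_ : ∀ {A B : Set} → (A → A → Set) → (B → B → Set) → A × B → A × B → Set
  (_~_ ×-rel _≋_) (a , b) (a′ , b′) = a ~ a′ × b ≋ b′

  enumeration-× : ∀ {A B : Set} {_~_ : A → A → Set} {_≋_ : B → B → Set} {P : A → Set} {Q : B → Set} {N M} →
    Enumeration A _~_ P N → Enumeration B _≋_ Q M →
    Enumeration (A × B) (_~_ ×-rel _≋_) (λ (a , b) → P a × Q b) (N ℕ.* M)
  enumeration-× {_~_ = _~_} {_≋_} {N = N} {M} (f , f-P , f-injective , f-surjective) (g , g-Q , g-injective , g-surjective) =
    (λ x → f (quotient M x) , g (remainder {N} M x)) , (λ x → f-P _ , g-Q _) ,
    (λ x y (fx~fy , gx≋gy) → trans (sym (Finₚ.combine-remQuot {N} M x))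
      (trans (cong₂ combine (f-injective _ _ fx~fy) (g-injective _ _ gx≋gy)) (Finₚ.combine-remQuot {N} M y))) ,
    λ (a , b) (Pa , Qb) → let i , fi~a = f-surjective a Pa ; j , gj≋b = g-surjective b Qb in
      combine i j , subst (λ (i′ , j′) → f i′ ~ a × g j′ ≋ b) (sym (Finₚ.remQuot-combine i j)) (fi~a , gj≋b)

  enumeration-Fin : ∀ N → Enumeration (Fin N) _≡_ (λ _ → ⊤) N
  enumeration-Fin N = (λ j → j) , (λ _ → tt) , (λ j j′ j≡j′ → j≡j′) , (λ a _ → a , refl)

  Pointwise : ∀ {n} {A : Set} → (A → A → Set) → (Fin n → A) → (Fin n → A) → Set
  Pointwise _~_ f g = ∀ i → f i ~ g i

  enumeration-→ : ∀ {A : Set} {_~_ : A → A → Set} {P : A → Set} {N} →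
    (∀ {x} → x ~ x) → (∀ {x y z} → x ~ y → y ~ z → x ~ z) →
    Enumeration A _~_ P N → ∀ n → Enumeration (Fin n → A) (Pointwise _~_) (λ f → ∀ i → P (f i)) (N ^ n)
  enumeration-→ ~-refl ~-trans E zero =
    (λ _ ()) , (λ _ ()) , (λ { Fin.zero Fin.zero _ → refl }) , (λ _ _ → Fin.zero , λ ())
  enumeration-→ {A} {_~_} {P} ~-refl ~-trans E (suc n) =
    enumeration-map {_~_ = _~_ ×-rel Pointwise _~_} {_≋_ = Pointwise _~_}
      (λ f~g g~h i → ~-trans (f~g i) (g~h i)) cons cons-cong cons-P
      (λ _ _ _ _ cons≋cons → cons≋cons Fin.zero , cons≋cons ∘ Fin.suc)
      (λ f Pf → (f Fin.zero , f ∘ Fin.suc) , (Pf Fin.zero , Pf ∘ Fin.suc) , cons-uncons f)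
      (enumeration-× {_~_ = _~_} {_≋_ = Pointwise _~_} E (enumeration-→ ~-refl ~-trans E n))
    where
    cons : A × (Fin n → A) → Fin (suc n) → A
    cons (a , f) Fin.zero    = a
    cons (a , f) (Fin.suc i) = f i
    cons-cong : ∀ {x y} → (_~_ ×-rel Pointwise _~_) x y → Pointwise _~_ (cons x) (cons y)
    cons-cong (a~b , f~g) Fin.zero    = a~b
    cons-cong (a~b , f~g) (Fin.suc i) = f~g i
    cons-P : ∀ x → P (proj₁ x) × (∀ i → P (proj₂ x i)) → ∀ i → P (cons x i)
    cons-P x (Pa , Pf) Fin.zero    = Pa
    cons-P x (Pa , Pf) (Fin.suc i) = Pf i
    cons-uncons : ∀ f → Pointwise _~_ (cons (f Fin.zero , f ∘ Fin.suc)) f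
    cons-uncons f Fin.zero    = ~-refl
    cons-uncons f (Fin.suc i) = ~-refl

  ≈-trans : ∀ {n} {π ρ σ : Permutation′ n} → π ≈ ρ → ρ ≈ σ → π ≈ σ
  ≈-trans π≈ρ ρ≈σ i = trans (π≈ρ i) (ρ≈σ i)

  enumeration-Permutation : ∀ k → Enumeration (Permutation′ k) _≈_ (λ _ → ⊤) (k !)
  enumeration-Permutation zero =
    (λ _ → Perm.id) , (λ _ → tt) , (λ { Fin.zero Fin.zero _ → refl }) , (λ _ _ → Fin.zero , λ ())
  enumeration-Permutation (suc k) =
    enumeration-map {_~_ = _≡_ ×-rel _≈_} {_≋_ = _≈_} (λ {π} {ρ} {σ} → ≈-trans {π = π} {ρ} {σ}) φ φ-cong (λ _ _ → tt) φ-injective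
      (λ π _ → (π ⟨$⟩ʳ Fin.zero , remove Fin.zero π) , (tt , tt) , insert-remove Fin.zero π)
      (enumeration-× {_~_ = _≡_} {_≋_ = _≈_} (enumeration-Fin (suc k)) (enumeration-Permutation k))
    where
    φ : Fin (suc k) × Permutation′ k → Permutation′ (suc k)
    φ (j , σ) = insert Fin.zero j σ
    φ-cong : ∀ {a a′} → (_≡_ ×-rel _≈_) a a′ → φ a ≈ φ a′
    φ-cong (refl , σ≈σ′) Fin.zero    = refl
    φ-cong {j , _} (refl , σ≈σ′) (Fin.suc x) = cong (punchIn j) (σ≈σ′ x)
    φ-injective : ∀ a a′ → ⊤ × ⊤ → ⊤ × ⊤ → φ a ≈ φ a′ → (_≡_ ×-rel _≈_) a a′
    φ-injective (j , σ) (j′ , σ′) _ _ φ≈φ′ with φ≈φ′ Fin.zero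
    ... | refl = refl , λ x → Finₚ.punchIn-injective j _ _ (φ≈φ′ (Fin.suc x))

  module WreathCount {n′ k₀ : ℕ}
    (red : Fin (suc k₀ ℕ.* n′) → Fin n′)
    (red∘combine : ∀ (a : Fin (suc k₀)) j → red (combine a j) ≡ j)
    (PA : Permutation′ (suc k₀ ℕ.* n′) → Set) (PA′ : Permutation′ n′ → Set)
    (PA⇔induces : ∀ π → PA π ⇔ (∃[ τ ] (PA′ τ × ∀ i → red (π ⟨$⟩ʳ i) ≡ τ ⟨$⟩ʳ red i)))
    where

    k = suc k₀
    n = k ℕ.* n′

    quo : Fin n → Fin k
    quo = quotient {k} n′

    rem : Fin n → Fin n′
    rem = remainder {k} n′

    quo-combine : ∀ a j → quo (combine a j) ≡ a
    quo-combine a j = cong proj₁ (Finₚ.remQuot-combine a j)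

    rem-combine : ∀ a j → rem (combine a j) ≡ j
    rem-combine a j = cong proj₂ (Finₚ.remQuot-combine a j)

    combine-quo-rem : ∀ x → combine (quo x) (rem x) ≡ x
    combine-quo-rem = Finₚ.combine-remQuot {k} n′

    red≗rem : ∀ x → red x ≡ rem x
    red≗rem x = trans (cong red (sym (combine-quo-rem x))) (red∘combine (quo x) (rem x))

    -- (σs , τ) sends position combine a j (block a, offset j) to combine (σs j a) (τ j).
    wreath : (Fin n′ → Permutation′ k) × Permutation′ n′ → Permutation′ n
    wreath (σs , τ) = permutation to from to∘from from∘to
      where
      to from : Fin n → Fin n
      to   x = combine (σs (rem x) ⟨$⟩ʳ quo x) (τ ⟨$⟩ʳ rem x)
      from x = combine (σs (τ ⟨$⟩ˡ rem x) ⟨$⟩ˡ quo x) (τ ⟨$⟩ˡ rem x)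
      to∘from : ∀ x → to (from x) ≡ x
      to∘from x = trans (cong₂ combine
        (trans (cong₂ (λ r b → σs r ⟨$⟩ʳ b) (rem-combine a j) (quo-combine a j)) (inverseʳ (σs j)))
        (trans (cong (τ ⟨$⟩ʳ_) (rem-combine a j)) (inverseʳ τ))) (combine-quo-rem x)
        where
        j = τ ⟨$⟩ˡ rem x
        a = σs j ⟨$⟩ˡ quo x
      from∘to : ∀ x → from (to x) ≡ x
      from∘to x = trans (cong₂ combine
        (trans (cong₂ (λ r b → σs r ⟨$⟩ˡ b) τ⁻¹τr≡r (quo-combine a j)) (inverseˡ (σs (rem x))))
        τ⁻¹τr≡r) (combine-quo-rem x)
        where
        j = τ ⟨$⟩ʳ rem x
        a = σs (rem x) ⟨$⟩ʳ quo x
        τ⁻¹τr≡r : τ ⟨$⟩ˡ rem (combine a j) ≡ rem x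
        τ⁻¹τr≡r = trans (cong (τ ⟨$⟩ˡ_) (rem-combine a j)) (inverseˡ τ)

    wreath-combine : ∀ σs τ a j → wreath (σs , τ) ⟨$⟩ʳ combine a j ≡ combine (σs j ⟨$⟩ʳ a) (τ ⟨$⟩ʳ j)
    wreath-combine σs τ a j =
      cong₂ combine (cong₂ (λ r b → σs r ⟨$⟩ʳ b) (rem-combine a j) (quo-combine a j)) (cong (τ ⟨$⟩ʳ_) (rem-combine a j))

    Factors : (Fin n′ → Permutation′ k) × Permutation′ n′ → Set
    Factors (_ , τ) = (Fin n′ → ⊤) × PA′ τ

    wreath-PA : ∀ x → Factors x → PA (wreath x)
    wreath-PA (σs , τ) (_ , τ∈PA′) = Equivalence.from (PA⇔induces (wreath (σs , τ))) (τ , τ∈PA′ , λ x →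
      trans (red∘combine (σs (rem x) ⟨$⟩ʳ quo x) (τ ⟨$⟩ʳ rem x)) (cong (τ ⟨$⟩ʳ_) (sym (red≗rem x))))

    wreath-cong : ∀ {x y} → (Pointwise _≈_ ×-rel _≈_) x y → wreath x ≈ wreath y
    wreath-cong (σs≈σs′ , τ≈τ′) x = cong₂ combine (σs≈σs′ (rem x) (quo x)) (τ≈τ′ (rem x))

    wreath-injective : ∀ x y → Factors x → Factors y → wreath x ≈ wreath y → (Pointwise _≈_ ×-rel _≈_) x y
    wreath-injective (σs , τ) (σs′ , τ′) _ _ wreath≈ =
      (λ j a → Finₚ.combine-injectiveˡ (σs j ⟨$⟩ʳ a) (τ ⟨$⟩ʳ j) (σs′ j ⟨$⟩ʳ a) (τ′ ⟨$⟩ʳ j) (at a j)) ,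
      (λ j → Finₚ.combine-injectiveʳ (σs j ⟨$⟩ʳ Fin.zero) (τ ⟨$⟩ʳ j) (σs′ j ⟨$⟩ʳ Fin.zero) (τ′ ⟨$⟩ʳ j) (at Fin.zero j))
      where
      at : ∀ a j → combine (σs j ⟨$⟩ʳ a) (τ ⟨$⟩ʳ j) ≡ combine (σs′ j ⟨$⟩ʳ a) (τ′ ⟨$⟩ʳ j)
      at a j = trans (sym (wreath-combine σs τ a j)) (trans (wreath≈ (combine a j)) (wreath-combine σs′ τ′ a j))

    wreath-surjective : ∀ π → PA π → ∃[ x ] (Factors x × wreath x ≈ π)
    wreath-surjective π π∈PA with Equivalence.to (PA⇔induces π) π∈PA
    ... | τ , τ∈PA′ , red∘π≗τ∘red = (σs , τ) , ((λ _ → tt) , τ∈PA′) , wreath≈π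
      where
      rem∘π : ∀ x → rem (π ⟨$⟩ʳ x) ≡ τ ⟨$⟩ʳ rem x
      rem∘π x = trans (sym (red≗rem _)) (trans (red∘π≗τ∘red x) (cong (τ ⟨$⟩ʳ_) (red≗rem x)))
      rem∘π⁻¹ : ∀ b j → rem (π ⟨$⟩ˡ combine b (τ ⟨$⟩ʳ j)) ≡ j
      rem∘π⁻¹ b j = trans (sym (inverseˡ τ)) (trans (cong (τ ⟨$⟩ˡ_)
        (trans (sym (rem∘π (π ⟨$⟩ˡ combine b (τ ⟨$⟩ʳ j)))) (trans (cong rem (inverseʳ π)) (rem-combine b _))))
        (inverseˡ τ))
      σs : Fin n′ → Permutation′ k
      σs j = permutation (λ a → quo (π ⟨$⟩ʳ combine a j)) (λ b → quo (π ⟨$⟩ˡ combine b (τ ⟨$⟩ʳ j))) to∘from from∘to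
        where
        to∘from : ∀ b → quo (π ⟨$⟩ʳ combine (quo (π ⟨$⟩ˡ combine b (τ ⟨$⟩ʳ j))) j) ≡ b
        to∘from b = trans
          (cong (λ z → quo (π ⟨$⟩ʳ z)) (trans (cong (combine (quo y)) (sym (rem∘π⁻¹ b j))) (combine-quo-rem y)))
          (trans (cong quo (inverseʳ π)) (quo-combine b _))
          where y = π ⟨$⟩ˡ combine b (τ ⟨$⟩ʳ j)
        from∘to : ∀ a → quo (π ⟨$⟩ˡ combine (quo (π ⟨$⟩ʳ combine a j)) (τ ⟨$⟩ʳ j)) ≡ a
        from∘to a = trans
          (cong (λ z → quo (π ⟨$⟩ˡ z)) (trans (cong (combine (quo z))
            (trans (sym (cong (τ ⟨$⟩ʳ_) (rem-combine a j))) (sym (rem∘π (combine a j))))) (combine-quo-rem z)))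
          (trans (cong quo (inverseˡ π)) (quo-combine a j))
          where z = π ⟨$⟩ʳ combine a j
      wreath≈π : wreath (σs , τ) ≈ π
      wreath≈π x = trans (cong₂ combine (cong (λ z → quo (π ⟨$⟩ʳ z)) (combine-quo-rem x)) (sym (rem∘π x)))
                         (combine-quo-rem (π ⟨$⟩ʳ x))

    count : ∀ N′ → Enumeration (Permutation′ n′) _≈_ PA′ N′ → Enumeration (Permutation′ n) _≈_ PA ((k !) ^ n′ ℕ.* N′)
    count N′ enum′ =
      enumeration-map {_~_ = Pointwise _≈_ ×-rel _≈_} {_≋_ = _≈_} (λ {π} {ρ} {σ} → ≈-trans {π = π} {ρ} {σ})
        wreath (λ {x} {y} → wreath-cong {x} {y}) wreath-PA wreath-injective wreath-surjective
        (enumeration-× {_~_ = Pointwise _≈_} {_≋_ = _≈_}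
          (enumeration-→ (λ _ → refl) (λ {π} {ρ} {σ} → ≈-trans {π = π} {ρ} {σ}) (enumeration-Permutation k) n′)
          enum′)

module AffineGroup where

  open import Data.Nat.Coprimality using (coprime?)
  import Data.Nat.Coprimality as Coprimality
  import Data.Vec as Vec
  import Data.Vec.Properties as Vecₚ
  open import Relation.Nullary.Decidable using (_×-dec_; _→-dec_; ¬?; from-yes)

  transpose-fix : ∀ {n} {a b k : Fin n} → k ≢ a → k ≢ b → transpose a b ⟨$⟩ʳ k ≡ k
  transpose-fix {a = a} {b} {k} k≢a k≢b with k Finₚ.≟ a
  ... | yes k≡a = ⊥-elim (k≢a k≡a)
  ... | no _ with k Finₚ.≟ b
  ...   | yes k≡b = ⊥-elim (k≢b k≡b)
  ...   | no _    = refl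

  transpose-resp : ∀ {A : Set} {n} (f : Fin n → A) (a b : Fin n) → f a ≡ f b →
                   ∀ k → f (transpose a b ⟨$⟩ʳ k) ≡ f k
  transpose-resp f a b fa≡fb k with k Finₚ.≟ a
  ... | yes refl = sym fa≡fb
  ... | no _ with k Finₚ.≟ b
  ...   | yes refl = fa≡fb
  ...   | no _     = refl

  transpose-≡ˡ : ∀ {n} (a b : Fin n) → transpose a b ⟨$⟩ʳ a ≡ b
  transpose-≡ˡ a b with a Finₚ.≟ a
  ... | yes _   = refl
  ... | no a≢a  = ⊥-elim (a≢a refl)

  -- An affine map fixing 0 and 1 is the identity.
  transposition-not-affine : ∀ {n} (n≥1 : 1 ≤ n) (a b : Fin n) → 2 ≤ toℕ a → 2 ≤ toℕ b → a ≢ b →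
                             ¬ InAG n≥1 (transpose a b)
  transposition-not-affine {suc n₀} n≥1 a b 2≤a 2≤b a≢b (t , a₀ , _ , π≗affine) =
    a≢b (Finₚ.toℕ-injective a≡b)
    where
    open ≡-Reasoning
    n = suc n₀
    value : ∀ i → (t ℕ.* toℕ i ℕ.+ a₀) ℕ.% n ≡ toℕ (transpose a b ⟨$⟩ʳ i)
    value i = sym (trans (cong toℕ (π≗affine i)) (toℕ-reduce n≥1 (t ℕ.* toℕ i ℕ.+ a₀)))
    fixed : ∀ j → j < 2 → (j<n : j < n) → (t ℕ.* j ℕ.+ a₀) ℕ.% n ≡ j
    fixed j j<2 j<n = begin
      (t ℕ.* j ℕ.+ a₀) ℕ.% n                         ≡⟨ cong (λ x → (t ℕ.* x ℕ.+ a₀) ℕ.% n) (Finₚ.toℕ-fromℕ< j<n) ⟨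
      (t ℕ.* toℕ (Fin.fromℕ< j<n) ℕ.+ a₀) ℕ.% n      ≡⟨ value (Fin.fromℕ< j<n) ⟩
      toℕ (transpose a b ⟨$⟩ʳ Fin.fromℕ< j<n)        ≡⟨ cong toℕ (transpose-fix (below 2≤a) (below 2≤b)) ⟩
      toℕ (Fin.fromℕ< j<n)                           ≡⟨ Finₚ.toℕ-fromℕ< j<n ⟩
      j                                              ∎
      where
      below : ∀ {c} → 2 ≤ toℕ c → Fin.fromℕ< j<n ≢ c
      below 2≤c j≡c = ℕₚ.<⇒≱ j<2 (subst (2 ≤_) (trans (cong toℕ (sym j≡c)) (Finₚ.toℕ-fromℕ< j<n)) 2≤c)
    2<n : 2 < n
    2<n = ℕₚ.≤-<-trans 2≤a (Finₚ.toℕ<n a)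
    n∣a₀ : n ℕᵈ.∣ a₀
    n∣a₀ = ℕᵈ.m%n≡0⇒n∣m a₀ n (trans (cong (λ x → (x ℕ.+ a₀) ℕ.% n) (sym (ℕₚ.*-zeroʳ t)))
                                      (fixed 0 (s≤s z≤n) (ℕₚ.<-trans (s≤s z≤n) 2<n)))
    t%n≡1 : t ℕ.% n ≡ 1
    t%n≡1 = begin
      t ℕ.% n                          ≡⟨ cong (ℕ._% n) (ℕₚ.*-identityʳ t) ⟨
      (t ℕ.* 1) ℕ.% n                  ≡⟨ ℕ.%-remove-+ʳ (t ℕ.* 1) n∣a₀ ⟨
      (t ℕ.* 1 ℕ.+ a₀) ℕ.% n           ≡⟨ fixed 1 (s≤s (s≤s z≤n)) (ℕₚ.<-trans (s≤s (s≤s z≤n)) 2<n) ⟩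
      1                                ∎
    a≡b : toℕ a ≡ toℕ b
    a≡b = begin
      toℕ a                                         ≡⟨ ℕ.m<n⇒m%n≡m (Finₚ.toℕ<n a) ⟨
      toℕ a ℕ.% n                                   ≡⟨ ℕ.m%n%n≡m%n (toℕ a) n ⟨
      toℕ a ℕ.% n ℕ.% n                             ≡⟨ cong (ℕ._% n) (ℕₚ.*-identityˡ (toℕ a ℕ.% n)) ⟨
      (1 ℕ.* (toℕ a ℕ.% n)) ℕ.% n                   ≡⟨ cong (λ x → (x ℕ.* (toℕ a ℕ.% n)) ℕ.% n) t%n≡1 ⟨
      ((t ℕ.% n) ℕ.* (toℕ a ℕ.% n)) ℕ.% n           ≡⟨ ℕ.%-distribˡ-* t (toℕ a) n ⟨
      (t ℕ.* toℕ a) ℕ.% n                           ≡⟨ ℕ.%-remove-+ʳ (t ℕ.* toℕ a) n∣a₀ ⟨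
      (t ℕ.* toℕ a ℕ.+ a₀) ℕ.% n                    ≡⟨ value a ⟩
      toℕ (transpose a b ⟨$⟩ʳ a)                    ≡⟨ cong toℕ (transpose-≡ˡ a b) ⟩
      toℕ b                                         ∎

  AffineOn : ∀ {n} → 1 ≤ n → (Fin n → Fin n) → Set
  AffineOn {n} n≥1 f = ∃[ t ] ∃[ a ] (Coprime (toℕ {n} t) n × ∀ i → f i ≡ reduce n≥1 (toℕ t ℕ.* toℕ i ℕ.+ toℕ {n} a))

  affineOn? : ∀ {n} (n≥1 : 1 ≤ n) f → Dec (AffineOn n≥1 f)
  affineOn? {n} n≥1 f = Finₚ.any? λ t → Finₚ.any? λ a →
    coprime? (toℕ t) n ×-dec Finₚ.all? λ i → f i Finₚ.≟ reduce n≥1 (toℕ t ℕ.* toℕ i ℕ.+ toℕ a)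

  affineOn-table⇒InAG : ∀ {n} (n≥1 : 1 ≤ n) π → AffineOn n≥1 (Vec.lookup (Vec.tabulate (π ⟨$⟩ʳ_))) → InAG n≥1 π
  affineOn-table⇒InAG n≥1 π (t , a , t⊥n , table≗affine) =
    toℕ t , toℕ a , t⊥n , λ i → trans (sym (Vecₚ.lookup∘tabulate (π ⟨$⟩ʳ_) i)) (table≗affine i)

  S₂⊆AG : ∀ (n≥1 : 1 ≤ 2) → ∀ a b → a ≢ b → AffineOn n≥1 (Vec.lookup (a ∷ b ∷ []))
  S₂⊆AG n≥1 = from-yes (Finₚ.all? λ a → Finₚ.all? λ b → ¬? (a Finₚ.≟ b) →-dec affineOn? n≥1 (Vec.lookup (a ∷ b ∷ [])))

  S₃⊆AG : ∀ (n≥1 : 1 ≤ 3) → ∀ a b c → a ≢ b × a ≢ c × b ≢ c → AffineOn n≥1 (Vec.lookup (a ∷ b ∷ c ∷ []))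
  S₃⊆AG n≥1 = from-yes (Finₚ.all? λ a → Finₚ.all? λ b → Finₚ.all? λ c →
    (¬? (a Finₚ.≟ b) ×-dec ¬? (a Finₚ.≟ c) ×-dec ¬? (b Finₚ.≟ c)) →-dec affineOn? n≥1 (Vec.lookup (a ∷ b ∷ c ∷ [])))

  -- reduce ignores its proof argument, so parity is definitionally reduce n′≥1 ∘ toℕ.
  parity : Fin 4 → Fin 2
  parity i = reduce (s≤s z≤n) (toℕ i)

  S₂≀S₂⊆AG : ∀ (n≥1 : 1 ≤ 4) → ∀ a b c d →
    a ≢ b × a ≢ c × a ≢ d × b ≢ c × b ≢ d × c ≢ d × parity a ≡ parity c × parity b ≡ parity d →
    AffineOn n≥1 (Vec.lookup (a ∷ b ∷ c ∷ d ∷ []))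
  S₂≀S₂⊆AG n≥1 = from-yes (Finₚ.all? λ a → Finₚ.all? λ b → Finₚ.all? λ c → Finₚ.all? λ d →
    (¬? (a Finₚ.≟ b) ×-dec ¬? (a Finₚ.≟ c) ×-dec ¬? (a Finₚ.≟ d) ×-dec ¬? (b Finₚ.≟ c) ×-dec ¬? (b Finₚ.≟ d)
      ×-dec ¬? (c Finₚ.≟ d) ×-dec parity a Finₚ.≟ parity c ×-dec parity b Finₚ.≟ parity d)
    →-dec affineOn? n≥1 (Vec.lookup (a ∷ b ∷ c ∷ d ∷ [])))

  permutation-injective : ∀ {n} (π : Permutation′ n) {i j} → i ≢ j → π ⟨$⟩ʳ i ≢ π ⟨$⟩ʳ j
  permutation-injective π i≢j πi≡πj = i≢j (trans (sym (inverseˡ π)) (trans (cong (π ⟨$⟩ˡ_) πi≡πj) (inverseˡ π)))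

  every-permutation-affine : ∀ {n} (n≥1 : 1 ≤ n) → n ≡ 2 ⊎ n ≡ 3 → ∀ π → InAG n≥1 π
  every-permutation-affine n≥1 (inj₁ refl) π =
    affineOn-table⇒InAG n≥1 π (S₂⊆AG n≥1 _ _ (permutation-injective π λ ()))
  every-permutation-affine n≥1 (inj₂ refl) π =
    affineOn-table⇒InAG n≥1 π (S₃⊆AG n≥1 _ _ _ (injective (λ ()) , injective (λ ()) , injective (λ ())))
    where injective = permutation-injective π

  coprime⇒%≢0 : ∀ {n q} d .{{_ : ℕ.NonZero d}} → 2 ≤ d → d ℕᵈ.∣ n → Coprime n q → q ℕ.% d ≢ 0
  coprime⇒%≢0 {q = q} d 2≤d d∣n n⊥q q%d≡0 = ℕₚ.<⇒≢ 2≤d (sym (n⊥q (d∣n , ℕᵈ.m%n≡0⇒n∣m q d q%d≡0)))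

  %2≢0⇒≡1 : ∀ x → x ℕ.% 2 ≢ 0 → x ℕ.% 2 ≡ 1
  %2≢0⇒≡1 x x%2≢0 with x ℕ.% 2 | ℕ.m%n<n x 2
  ... | 0 | _ = ⊥-elim (x%2≢0 refl)
  ... | 1 | _ = refl
  ... | suc (suc _) | s≤s (s≤s ())

  %3≢0⇒≡1⊎≡2 : ∀ x → x ℕ.% 3 ≢ 0 → x ℕ.% 3 ≡ 1 ⊎ x ℕ.% 3 ≡ 2
  %3≢0⇒≡1⊎≡2 x x%3≢0 with x ℕ.% 3 | ℕ.m%n<n x 3
  ... | 0 | _ = ⊥-elim (x%3≢0 refl)
  ... | 1 | _ = inj₁ refl
  ... | 2 | _ = inj₂ refl
  ... | suc (suc (suc _)) | s≤s (s≤s (s≤s ()))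

  coprime-to-even⇒odd : ∀ {n q} → 2 ℕᵈ.∣ n → Coprime n q → q ℕ.% 2 ≡ 1
  coprime-to-even⇒odd {q = q} 2∣n n⊥q = %2≢0⇒≡1 q (coprime⇒%≢0 2 ℕₚ.≤-refl 2∣n n⊥q)

  coprime-to-3∣⇒%3≡1⊎2 : ∀ {n q} → 3 ℕᵈ.∣ n → Coprime n q → q ℕ.% 3 ≡ 1 ⊎ q ℕ.% 3 ≡ 2
  coprime-to-3∣⇒%3≡1⊎2 {q = q} 3∣n n⊥q = %3≢0⇒≡1⊎≡2 q (coprime⇒%≢0 3 (s≤s (s≤s z≤n)) 3∣n n⊥q)

  affine-parity : ∀ t a x → t ℕ.% 2 ≡ 1 → (t ℕ.* x ℕ.+ a) ℕ.% 4 ℕ.% 2 ≡ (x ℕ.% 2 ℕ.+ a ℕ.% 2) ℕ.% 2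
  affine-parity t a x t%2≡1 = begin
    (t ℕ.* x ℕ.+ a) ℕ.% 4 ℕ.% 2                  ≡⟨ ℕ.m∣n⇒o%n%m≡o%m 2 4 (t ℕ.* x ℕ.+ a) (ℕᵈ.divides 2 refl) ⟩
    (t ℕ.* x ℕ.+ a) ℕ.% 2                        ≡⟨ ℕ.%-distribˡ-+ (t ℕ.* x) a 2 ⟩
    ((t ℕ.* x) ℕ.% 2 ℕ.+ a ℕ.% 2) ℕ.% 2          ≡⟨ cong (λ z → (z ℕ.+ a ℕ.% 2) ℕ.% 2) tx%2≡x%2 ⟩
    (x ℕ.% 2 ℕ.+ a ℕ.% 2) ℕ.% 2                  ∎
    where
    open ≡-Reasoning
    tx%2≡x%2 : (t ℕ.* x) ℕ.% 2 ≡ x ℕ.% 2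
    tx%2≡x%2 = begin
      (t ℕ.* x) ℕ.% 2                    ≡⟨ ℕ.%-distribˡ-* t x 2 ⟩
      ((t ℕ.% 2) ℕ.* (x ℕ.% 2)) ℕ.% 2    ≡⟨ cong (λ z → (z ℕ.* (x ℕ.% 2)) ℕ.% 2) t%2≡1 ⟩
      (1 ℕ.* (x ℕ.% 2)) ℕ.% 2            ≡⟨ cong (ℕ._% 2) (ℕₚ.*-identityˡ (x ℕ.% 2)) ⟩
      x ℕ.% 2 ℕ.% 2                      ≡⟨ ℕ.m%n%n≡m%n x 2 ⟩
      x ℕ.% 2                            ∎

  translate₂ : Fin 2 → Permutation′ 2
  translate₂ Fin.zero = Perm.id
  translate₂ (Fin.suc Fin.zero) = transpose Fin.zero (Fin.suc Fin.zero)

  toℕ-translate₂ : ∀ b j → toℕ (translate₂ b ⟨$⟩ʳ j) ≡ (toℕ j ℕ.+ toℕ b) ℕ.% 2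
  toℕ-translate₂ Fin.zero           Fin.zero           = refl
  toℕ-translate₂ Fin.zero           (Fin.suc Fin.zero) = refl
  toℕ-translate₂ (Fin.suc Fin.zero) Fin.zero           = refl
  toℕ-translate₂ (Fin.suc Fin.zero) (Fin.suc Fin.zero) = refl

  lift⇔affine₄ : ∀ {n n′} → n ≡ 4 → n′ ≡ 2 → (n≥1 : 1 ≤ n) (n′≥1 : 1 ≤ n′) → ∀ π →
    (∃[ τ ] ∀ i → reduce n′≥1 (toℕ (π ⟨$⟩ʳ i)) ≡ τ ⟨$⟩ʳ reduce n′≥1 (toℕ i)) ⇔ InAG n≥1 π
  lift⇔affine₄ refl refl n≥1 n′≥1 π = mk⇔ to from
    where
    injective = permutation-injective π
    to : ∃[ τ ] (∀ i → reduce n′≥1 (toℕ (π ⟨$⟩ʳ i)) ≡ τ ⟨$⟩ʳ reduce n′≥1 (toℕ i)) → InAG n≥1 π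
    to (τ , lift) = affineOn-table⇒InAG n≥1 π (S₂≀S₂⊆AG n≥1 _ _ _ _
      (injective (λ ()) , injective (λ ()) , injective (λ ()) , injective (λ ()) , injective (λ ()) , injective (λ ()) ,
       trans (lift Fin.zero) (sym (lift (Fin.suc (Fin.suc Fin.zero)))) ,
       trans (lift (Fin.suc Fin.zero)) (sym (lift (Fin.suc (Fin.suc (Fin.suc Fin.zero)))))))
    from : InAG n≥1 π → ∃[ τ ] (∀ i → reduce n′≥1 (toℕ (π ⟨$⟩ʳ i)) ≡ τ ⟨$⟩ʳ reduce n′≥1 (toℕ i))
    from (t , a , t⊥4 , π≗affine) = translate₂ (reduce n′≥1 a) , λ i → Finₚ.toℕ-injective (begin
      toℕ (reduce n′≥1 (toℕ (π ⟨$⟩ʳ i)))                      ≡⟨ toℕ-reduce n′≥1 (toℕ (π ⟨$⟩ʳ i)) ⟩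
      toℕ (π ⟨$⟩ʳ i) ℕ.% 2                                   ≡⟨ cong (λ z → toℕ z ℕ.% 2) (π≗affine i) ⟩
      toℕ (reduce n≥1 (t ℕ.* toℕ i ℕ.+ a)) ℕ.% 2              ≡⟨ cong (ℕ._% 2) (toℕ-reduce n≥1 (t ℕ.* toℕ i ℕ.+ a)) ⟩
      (t ℕ.* toℕ i ℕ.+ a) ℕ.% 4 ℕ.% 2                         ≡⟨ affine-parity t a (toℕ i) t%2≡1 ⟩
      (toℕ i ℕ.% 2 ℕ.+ a ℕ.% 2) ℕ.% 2
        ≡⟨ cong₂ (λ x y → (x ℕ.+ y) ℕ.% 2) (toℕ-reduce n′≥1 (toℕ i)) (toℕ-reduce n′≥1 a) ⟨
      (toℕ (reduce n′≥1 (toℕ i)) ℕ.+ toℕ (reduce n′≥1 a)) ℕ.% 2 ≡⟨ toℕ-translate₂ (reduce n′≥1 a) (reduce n′≥1 (toℕ i)) ⟨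
      toℕ (translate₂ (reduce n′≥1 a) ⟨$⟩ʳ reduce n′≥1 (toℕ i)) ∎)
      where
      open ≡-Reasoning
      t%2≡1 : t ℕ.% 2 ≡ 1
      t%2≡1 = coprime-to-even⇒odd (ℕᵈ.divides 2 refl) (Coprimality.sym t⊥4)

  non-affine-lift-of-id : ∀ {n n′} (n≥1 : 1 ≤ n) (n′≥1 : 1 ≤ n′) → n′ ℕ.+ 3 ≤ n →
    ∃[ π ] ((∀ i → reduce n′≥1 (toℕ (π ⟨$⟩ʳ i)) ≡ Perm.id ⟨$⟩ʳ reduce n′≥1 (toℕ i)) × ¬ InAG n≥1 π)
  non-affine-lift-of-id {n} {suc n′₀} n≥1 n′≥1 n′+3≤n with ℕₚ.m≤n⇒∃[o]m+o≡n n′+3≤n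
  ... | o , n′+3+o≡n = transpose a b , transpose-resp red a b red-a≡red-b ,
                       transposition-not-affine n≥1 a b (subst (2 ≤_) (sym toℕ-a) 2≤A) (subst (2 ≤_) (sym toℕ-b) 2≤B) a≢b
    where
    n′ = suc n′₀
    B = 2 ℕ.+ o
    A = B ℕ.+ n′
    n≡1+A : n ≡ suc A
    n≡1+A = trans (sym n′+3+o≡n)
      (solve 2 (λ n′₀ o → (con 1 :+ n′₀ :+ con 3) :+ o := con 1 :+ ((con 2 :+ o) :+ (con 1 :+ n′₀))) refl n′₀ o)
    A<n : A < n
    A<n = subst (A <_) (sym n≡1+A) (ℕₚ.n<1+n A)
    B<n : B < n
    B<n = ℕₚ.≤-<-trans (ℕₚ.m≤m+n B n′) A<n
    a b : Fin n
    a = Fin.fromℕ< A<n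
    b = Fin.fromℕ< B<n
    toℕ-a : toℕ a ≡ A
    toℕ-a = Finₚ.toℕ-fromℕ< A<n
    toℕ-b : toℕ b ≡ B
    toℕ-b = Finₚ.toℕ-fromℕ< B<n
    2≤B : 2 ≤ B
    2≤B = ℕₚ.m≤m+n 2 o
    2≤A : 2 ≤ A
    2≤A = ℕₚ.≤-trans 2≤B (ℕₚ.m≤m+n B n′)
    a≢b : a ≢ b
    a≢b a≡b = ℕₚ.m+1+n≢m B (trans (sym toℕ-a) (trans (cong toℕ a≡b) toℕ-b))
    red : Fin n → Fin n′
    red i = reduce n′≥1 (toℕ i)
    red-a≡red-b : red a ≡ red b
    red-a≡red-b = Finₚ.toℕ-injective (begin
      toℕ (red a)        ≡⟨ toℕ-reduce n′≥1 (toℕ a) ⟩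
      toℕ a ℕ.% n′       ≡⟨ cong (ℕ._% n′) toℕ-a ⟩
      (B ℕ.+ n′) ℕ.% n′  ≡⟨ ℕ.[m+n]%n≡m%n B n′ ⟩
      B ℕ.% n′           ≡⟨ cong (ℕ._% n′) toℕ-b ⟨
      toℕ b ℕ.% n′       ≡⟨ toℕ-reduce n′≥1 (toℕ b) ⟨
      toℕ (red b)        ∎)
      where open ≡-Reasoning

  S₂-cases : ∀ (τ : Permutation′ 2) → τ Perm.≈ Perm.id ⊎ τ Perm.≈ transpose Fin.zero (Fin.suc Fin.zero)
  S₂-cases τ with τ ⟨$⟩ʳ Fin.zero in τ0 | τ ⟨$⟩ʳ Fin.suc Fin.zero in τ1
  ... | Fin.zero           | Fin.zero           = ⊥-elim (permutation-injective τ (λ ()) (trans τ0 (sym τ1)))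
  ... | Fin.zero           | Fin.suc Fin.zero   = inj₁ λ { Fin.zero → τ0 ; (Fin.suc Fin.zero) → τ1 }
  ... | Fin.suc Fin.zero   | Fin.zero           = inj₂ λ { Fin.zero → τ0 ; (Fin.suc Fin.zero) → τ1 }
  ... | Fin.suc Fin.zero   | Fin.suc Fin.zero   = ⊥-elim (permutation-injective τ (λ ()) (trans τ0 (sym τ1)))

  small-or-spread : ∀ n′₀ k₀ → let n′ = suc n′₀ ; n = suc (suc k₀) ℕ.* n′ in
    (n ≡ 2 × n′ ≡ 1) ⊎ (n ≡ 3 × n′ ≡ 1) ⊎ (n ≡ 4 × n′ ≡ 2) ⊎ n′ ℕ.+ 3 ≤ n
  small-or-spread zero             zero             = inj₁ (refl , refl)
  small-or-spread zero             (suc zero)       = inj₂ (inj₁ (refl , refl))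
  small-or-spread zero             (suc (suc k₀))   = inj₂ (inj₂ (inj₂ (s≤s (s≤s (s≤s (s≤s z≤n))))))
  small-or-spread (suc zero)       zero             = inj₂ (inj₂ (inj₁ (refl , refl)))
  small-or-spread (suc zero)       (suc k₀)         = inj₂ (inj₂ (inj₂ (s≤s (s≤s (s≤s (s≤s (s≤s z≤n)))))))
  small-or-spread (suc (suc n′₀))  k₀               =
    inj₂ (inj₂ (inj₂ (ℕₚ.+-monoʳ-≤ n′ (ℕₚ.≤-trans (s≤s (s≤s (s≤s z≤n))) (ℕₚ.m≤m+n n′ (k₀ ℕ.* n′))))))
    where n′ = suc (suc (suc n′₀))

module DegenerateCodes {q : ℕ} (𝔽 : FiniteField q) {m : ℕ} (h : Poly 𝔽) (monic-h : CyclicCodes.Monic 𝔽 m h) where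

  open FiniteField 𝔽 using (0#; 1#; -_)
  open CyclicCodes 𝔽
  open CheckPolynomial h monic-h
  open AffineGroup
  open Counting using (module WreathCount)

  Minimal : ℕ → Set
  Minimal n′ = ∀ k → 1 ≤ k → h ∣ xⁿ-1 k → n′ ≤ k

  IsRepetition : ℕ → ℕ → Set
  IsRepetition n n′ = ∀ (n′≥1 : 1 ≤ n′) → ∀ c →
    InCode 𝔽 n h c ⇔ (∃[ c′ ] (InCode 𝔽 n′ h c′ × ∀ i → c i ≡ c′ (reduce n′≥1 (toℕ i))))

  HasWreathPAut : ℕ → ℕ → Set
  HasWreathPAut n n′ = ∀ (n′≥1 : 1 ≤ n′) (k : ℕ) → n ≡ k ℕ.* n′ →
      (∀ π → InPAut 𝔽 (InCode 𝔽 n h) π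
         ⇔ (∃[ τ ] (InPAut 𝔽 (InCode 𝔽 n′ h) τ × ∀ i → reduce n′≥1 (toℕ (π ⟨$⟩ʳ i)) ≡ τ ⟨$⟩ʳ (reduce n′≥1 (toℕ i)))))
    × (∀ N′ → Card (InPAut 𝔽 (InCode 𝔽 n′ h)) N′ → Card (InPAut 𝔽 (InCode 𝔽 n h)) ((k !) ^ n′ ℕ.* N′))

  AffineDichotomy : (n n′ : ℕ) → 1 ≤ n → Set
  AffineDichotomy n n′ n≥1 =
      (Exceptional 𝔽 n n′ h → ∀ π → InPAut 𝔽 (InCode 𝔽 n h) π ⇔ InAG n≥1 π)
    × (¬ Exceptional 𝔽 n n′ h → ¬ (∀ π → InPAut 𝔽 (InCode 𝔽 n h) π → InAG n≥1 π))

  dimension : ∀ {n} → 1 ≤ n → h ∣ xⁿ-1 n → HasDim 𝔽 (InCode 𝔽 n h) m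
  dimension {suc n₀} _ h∣xⁿ-1 = Encoding.hasDim (generator n₀ h∣xⁿ-1)

  full-PAut-of-length-2 : ∀ {n′} → n′ ≡ 2 → Generator n′ → ∀ τ → InPAut 𝔽 (InCode 𝔽 n′ h) τ
  full-PAut-of-length-2 refl G′ τ with S₂-cases τ
  ... | inj₁ τ≈id   = InPAut-resp 𝔽 (InCode 𝔽 2 h) (λ {c} {d} → inCode-cong h {c} {d}) {Perm.id} {τ}
                        (λ i → sym (τ≈id i)) (InPAut-id 𝔽 (InCode 𝔽 2 h))
  ... | inj₂ τ≈swap = InPAut-resp 𝔽 (InCode 𝔽 2 h) (λ {c} {d} → inCode-cong h {c} {d}) {transpose Fin.zero (Fin.suc Fin.zero)} {τ}
                        (λ i → sym (τ≈swap i)) swap∈PAut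
    where
    open Rotation G′ using (inCode-cyclic)
    swap∈PAut : InPAut 𝔽 (InCode 𝔽 2 h) (transpose Fin.zero (Fin.suc Fin.zero))
    swap∈PAut c = mk⇔ (inCode-cyclic c) λ cσ∈C → inCode-cong h swap-swap (inCode-cyclic (c ∘ cyclicPred) cσ∈C)
      where
      swap-swap : ∀ i → c (cyclicPred (cyclicPred i)) ≡ c i
      swap-swap Fin.zero           = refl
      swap-swap (Fin.suc Fin.zero) = refl

  exceptional⇒¬spread : ∀ {n n′} → Exceptional 𝔽 n n′ h → ¬ (n′ ℕ.+ 3 ≤ n)
  exceptional⇒¬spread (inj₁ (refl , refl , _))               (s≤s (s≤s ()))
  exceptional⇒¬spread (inj₂ (inj₁ (refl , refl , _)))        (s≤s (s≤s (s≤s ())))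
  exceptional⇒¬spread (inj₂ (inj₂ (inj₁ (refl , refl , _)))) (s≤s (s≤s (s≤s (s≤s ()))))
  exceptional⇒¬spread (inj₂ (inj₂ (inj₂ (refl , refl , _)))) (s≤s (s≤s (s≤s (s≤s ()))))

  Fin1-irrelevant : ∀ {k} → k ≡ 1 → (x y : Fin k) → x ≡ y
  Fin1-irrelevant refl Fin.zero Fin.zero = refl

  module Degenerate {n′₀ k₀ : ℕ} (h∣xⁿ′-1 : h ∣ xⁿ-1 (suc n′₀)) (h∣xⁿ-1 : h ∣ xⁿ-1 (suc (suc k₀) ℕ.* suc n′₀))
                    (minimal : Minimal (suc n′₀)) where
    n′ = suc n′₀
    k  = suc (suc k₀)
    n  = k ℕ.* n′
    G′ = generator n′₀ h∣xⁿ′-1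
    G  = generator (n′₀ ℕ.+ suc k₀ ℕ.* n′) h∣xⁿ-1
    C  = InCode 𝔽 n h
    C′ = InCode 𝔽 n′ h

    red : 1 ≤ n′ → Fin n → Fin n′
    red n′≥1 i = reduce n′≥1 (toℕ i)

    ι : Fin n′ → Fin n
    ι j = Fin.inject≤ j (ℕₚ.m≤m+n n′ (suc k₀ ℕ.* n′))

    red∘ι : ∀ n′≥1 j → red n′≥1 (ι j) ≡ j
    red∘ι n′≥1 j = trans (cong (reduce n′≥1) (Finₚ.toℕ-inject≤ j (ℕₚ.m≤m+n n′ (suc k₀ ℕ.* n′)))) (reduce-toℕ n′≥1 j)

    repeated : IsRepetition n n′
    repeated = Repetition.inCode⇔repeated {n′₀} {suc k₀} G′ G

    PAut⇔induces : ∀ (n′≥1 : 1 ≤ n′) π → InPAut 𝔽 C π ⇔ (∃[ τ ] (InPAut 𝔽 C′ τ × ∀ i → red n′≥1 (π ⟨$⟩ʳ i) ≡ τ ⟨$⟩ʳ red n′≥1 i))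
    PAut⇔induces n′≥1 = WreathProduct.inPAut⇔inducesPAut 𝔽 {n} {n′} (red n′≥1) ι (red∘ι n′≥1) C C′
      (λ {c} {d} → inCode-cong h {c} {d}) (λ {c} {d} → inCode-cong h {c} {d}) (repeated n′≥1) (Separation.separates G′ minimal)

    wreath : HasWreathPAut n n′
    wreath n′≥1 k′ n≡k′n′ with ℕₚ.*-cancelʳ-≡ k k′ n′ n≡k′n′
    ... | refl = PAut⇔induces n′≥1 , λ N′ →
      WreathCount.count {n′} {suc k₀} (red n′≥1) (reduce-combine n′≥1) (InPAut 𝔽 C) (InPAut 𝔽 C′) (PAut⇔induces n′≥1) N′

    lift-of-id⇒PAut : ∀ n′≥1 π → (∀ i → red n′≥1 (π ⟨$⟩ʳ i) ≡ Perm.id ⟨$⟩ʳ red n′≥1 i) → InPAut 𝔽 C π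
    lift-of-id⇒PAut n′≥1 π lifts-id = Equivalence.from (PAut⇔induces n′≥1 π) (Perm.id , InPAut-id 𝔽 C′ , lifts-id)

    PAut⇔AG-of-length-1 : n′ ≡ 1 → n ≡ 2 ⊎ n ≡ 3 → (n≥1 : 1 ≤ n) → ∀ π → InPAut 𝔽 C π ⇔ InAG n≥1 π
    PAut⇔AG-of-length-1 n′≡1 n≡2⊎3 n≥1 π = mk⇔
      (λ _ → every-permutation-affine n≥1 n≡2⊎3 π)
      (λ _ → lift-of-id⇒PAut (s≤s z≤n) π λ i → Fin1-irrelevant n′≡1 _ _)

    PAut⇔AG-of-length-2 : n ≡ 4 → n′ ≡ 2 → (n≥1 : 1 ≤ n) → ∀ π → InPAut 𝔽 C π ⇔ InAG n≥1 π
    PAut⇔AG-of-length-2 n≡4 n′≡2 n≥1 π = mk⇔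
      (λ π∈PAut → let τ , _ , lifts-τ = Equivalence.to (PAut⇔induces n′≥1 π) π∈PAut
                  in Equivalence.to (lift⇔affine₄ n≡4 n′≡2 n≥1 n′≥1 π) (τ , lifts-τ))
      (λ π∈AG → let τ , lifts-τ = Equivalence.from (lift⇔affine₄ n≡4 n′≡2 n≥1 n′≥1 π) π∈AG
                in Equivalence.from (PAut⇔induces n′≥1 π) (τ , full-PAut-of-length-2 n′≡2 G′ τ , lifts-τ))
      where
      n′≥1 : 1 ≤ n′
      n′≥1 = s≤s z≤n

    h≈x-1 : 1 ≤ m → n′ ≡ 1 → h ≈ (- 1# ∷ 1# ∷ [])
    h≈x-1 1≤m n′≡1 = monic-∣x-1 h 1≤m monic-h (subst (λ j → h ∣ xⁿ-1 j) n′≡1 h∣xⁿ′-1)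

    dichotomy : (n≥1 : 1 ≤ n) → Coprime n q → 1 ≤ m → AffineDichotomy n n′ n≥1
    dichotomy n≥1 n⊥q 1≤m with small-or-spread n′₀ k₀
    ... | inj₁ (n≡2 , n′≡1) =
      (λ _ → PAut⇔AG-of-length-1 n′≡1 (inj₁ n≡2) n≥1) ,
      λ ¬exc → ⊥-elim (¬exc (inj₁ (n≡2 , n′≡1 , coeff≡ (h≈x-1 1≤m n′≡1) ,
                                   coprime-to-even⇒odd (subst (2 ℕᵈ.∣_) (sym n≡2) ℕᵈ.∣-refl) n⊥q)))
    ... | inj₂ (inj₁ (n≡3 , n′≡1)) =
      (λ _ → PAut⇔AG-of-length-1 n′≡1 (inj₂ n≡3) n≥1) ,
      λ ¬exc → ⊥-elim (¬exc (inj₂ (inj₁ (n≡3 , n′≡1 , coeff≡ (h≈x-1 1≤m n′≡1) ,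
                                         coprime-to-3∣⇒%3≡1⊎2 (subst (3 ℕᵈ.∣_) (sym n≡3) ℕᵈ.∣-refl) n⊥q))))
    ... | inj₂ (inj₂ (inj₁ (n≡4 , n′≡2))) =
      (λ _ → PAut⇔AG-of-length-2 n≡4 n′≡2 n≥1) ,
      λ ¬exc → ⊥-elim (¬exc (shape (monic-∣x²-1 h 1≤m monic-h (subst (λ j → h ∣ xⁿ-1 j) n′≡2 h∣xⁿ′-1) h∤x-1)))
      where
      q-odd : q ℕ.% 2 ≡ 1
      q-odd = coprime-to-even⇒odd (subst (2 ℕᵈ.∣_) (sym n≡4) (ℕᵈ.divides 2 refl)) n⊥q
      h∤x-1 : ¬ (h ∣ xⁿ-1 1)
      h∤x-1 h∣x-1 with subst (_≤ 1) n′≡2 (minimal 1 (s≤s z≤n) h∣x-1)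
      ... | s≤s ()
      shape : h ≈ (1# ∷ 1# ∷ []) ⊎ h ≈ (- 1# ∷ 0# ∷ 1# ∷ []) → Exceptional 𝔽 n n′ h
      shape (inj₁ h≈x+1)  = inj₂ (inj₂ (inj₁ (n≡4 , n′≡2 , coeff≡ h≈x+1 , q-odd)))
      shape (inj₂ h≈x²-1) = inj₂ (inj₂ (inj₂ (n≡4 , n′≡2 , coeff≡ h≈x²-1 , q-odd)))
    ... | inj₂ (inj₂ (inj₂ spread)) =
      (λ exc → ⊥-elim (exceptional⇒¬spread exc spread)) ,
      λ _ PAut⊆AG → let π , lifts-id , ¬affine = non-affine-lift-of-id n≥1 (s≤s z≤n) spread
                    in ¬affine (PAut⊆AG π (lift-of-id⇒PAut (s≤s z≤n) π lifts-id))

  degenerate : ∀ {n n′} (n≥1 : 1 ≤ n) → Coprime n q → h ∣ xⁿ-1 n → 1 ≤ n′ → h ∣ xⁿ-1 n′ → Minimal n′ →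
               n′ ℕᵈ.∣ n → n′ < n → IsRepetition n n′ × HasWreathPAut n n′ × (1 ≤ m → AffineDichotomy n n′ n≥1)
  degenerate n≥1 n⊥q h∣xⁿ-1 (s≤s z≤n) h∣xⁿ′-1 minimal (ℕᵈ.divides (suc (suc k₀)) refl) _ =
    repeated , wreath , dichotomy n≥1 n⊥q
    where open Degenerate {k₀ = k₀} h∣xⁿ′-1 h∣xⁿ-1 minimal
  degenerate _ _ _ (s≤s z≤n) _ _ (ℕᵈ.divides 1 refl) n′<n = ⊥-elim (ℕₚ.<-irrefl (sym (ℕₚ.+-identityʳ _)) n′<n)

-- Imported only here: inside CyclicCodes, _*_, _∣_ and xⁿ-1 denote field and polynomial operations.
open CyclicCodes using (monic-monic; ∣ₚ⇒∣; ∣⇒∣ₚ; ord∣)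
open import Data.Nat using (_*_)
open import Data.Nat.Divisibility using (_∣_)
open import Defs using (xⁿ-1)

lemma2p4 : ∀ {q} (𝔽 : FiniteField q) → IsPrimePower q
    → (n : ℕ) (n≥1 : 1 ≤ n) → Coprime n q
    → (m′ : ℕ) (hs : Vec (FiniteField.Carrier 𝔽) m′)
    → _∣ₚ_ 𝔽 (monic 𝔽 hs) (xⁿ-1 𝔽 n)
    → (n′ : ℕ) → IsOrd 𝔽 (monic 𝔽 hs) n′
    → n′ ∣ n
      × HasDim 𝔽 (InCode 𝔽 n (monic 𝔽 hs)) m′
      × (n′ < n →
          (∀ (n′≥1 : 1 ≤ n′) → ∀ c → InCode 𝔽 n (monic 𝔽 hs) c
              ⇔ (∃[ c′ ] (InCode 𝔽 n′ (monic 𝔽 hs) c′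
                   × ∀ i → c i ≡ c′ (reduce n′≥1 (toℕ i)))))
        × (∀ (n′≥1 : 1 ≤ n′) (k : ℕ) → n ≡ k * n′ →
              (∀ π → InPAut 𝔽 (InCode 𝔽 n (monic 𝔽 hs)) π
                 ⇔ (∃[ τ ] (InPAut 𝔽 (InCode 𝔽 n′ (monic 𝔽 hs)) τ
                      × ∀ i → reduce n′≥1 (toℕ (π ⟨$⟩ʳ i))
                                ≡ τ ⟨$⟩ʳ (reduce n′≥1 (toℕ i)))))
            × (∀ N′ → Card (InPAut 𝔽 (InCode 𝔽 n′ (monic 𝔽 hs))) N′
                 → Card (InPAut 𝔽 (InCode 𝔽 n (monic 𝔽 hs))) ((k !) ^ n′ * N′)))
        × (1 ≤ m′ →
              (Exceptional 𝔽 n n′ (monic 𝔽 hs)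
                 → ∀ π → InPAut 𝔽 (InCode 𝔽 n (monic 𝔽 hs)) π ⇔ InAG n≥1 π)
            × (¬ Exceptional 𝔽 n n′ (monic 𝔽 hs)
                 → ¬ (∀ π → InPAut 𝔽 (InCode 𝔽 n (monic 𝔽 hs)) π → InAG n≥1 π))))
lemma2p4 𝔽 _ n n≥1 n⊥q m′ hs h∣ₚxⁿ-1 n′ (n′≥1 , h∣ₚxⁿ′-1 , minimalₚ) =
  n′∣n , dimension n≥1 h∣xⁿ-1 , degenerate n≥1 n⊥q h∣xⁿ-1 n′≥1 h∣xⁿ′-1 minimal n′∣n
  where
  open DegenerateCodes 𝔽 (monic 𝔽 hs) (monic-monic 𝔽 hs)
  h∣xⁿ-1 = ∣ₚ⇒∣ 𝔽 h∣ₚxⁿ-1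
  h∣xⁿ′-1 = ∣ₚ⇒∣ 𝔽 h∣ₚxⁿ′-1
  minimal : Minimal n′
  minimal k k≥1 = minimalₚ k k≥1 ∘ ∣⇒∣ₚ 𝔽
  n′∣n : n′ ∣ n
  n′∣n = ord∣ 𝔽 n′≥1 h∣xⁿ′-1 minimal h∣xⁿ-1
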